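{- Let $G$ be a connected bridgeless graph, let $l \geq 0$ be an integer, and let $D^l$ be a connected $l$-step dominating set of $G$. Then $$rc(G) \leq rc(G[D^l]) + l(l+2) \leq |D^l| - 1 + l(l+2).$$
   Context: All graphs are finite, simple and undirected. A graph is bridgeless if it is $2$-edge-connected (no single edge removal disconnects it). $G[S]$ denotes the subgraph induced by $S \subseteq V(G)$, and $d_G(v,S) = \min_{x\in S} d_G(v,x)$. A set $D \subseteq V(G)$ is an $l$-step dominating set if every vertex of $G$ is at distance at most $l$ from $D$; it is a connected $l$-step dominating set if moreover $G[D]$ is connected. A path is a rainbow path if no two of its edges have the same colour; an edge colouring of a connected graph is a rainbow colouring if every pair of vertices is joined by a rainbow path; $rc(G)$ is the minimum number of colours in a rainbow colouring of the connected graph $G$ (with $rc$ of a single vertex equal to $0$). -}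

module Defs where

open import Data.Nat using (ℕ; zero; suc; _+_; _*_; _∸_; _≤_; _<_)
open import Data.Bool using (Bool; true; false)
open import Data.Fin using (Fin)
open import Data.Fin.Subset using (Subset; _∈_; ∣_∣)
open import Data.List using (List; []; _∷_)
open import Data.List.Relation.Unary.Unique.Propositional using (Unique)
open import Data.Product using (Σ; Σ-syntax; _×_; _,_; proj₁)
open import Relation.Binary.PropositionalEquality using (_≡_)
open import Relation.Nullary using (¬_)

-- A finite simple graph is a Graph (Fin n): symmetric, irreflexive
-- Bool-valued adjacency on a vertex type V.  The vertex type is kept
-- generic so that induced subgraphs can live on Σ-types.
record Graph (V : Set) : Set where
  field
    adj    : V → V → Bool
    sym    : ∀ u v → adj u v ≡ adj v u
    irrefl : ∀ u → adj u u ≡ false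

open Graph public

Adj : {V : Set} → Graph V → V → V → Set
Adj G u v = adj G u v ≡ true

data Walk {V : Set} (E : V → V → Set) : V → V → Set where
  []   : ∀ {u} → Walk E u u
  step : ∀ {u w v} → E u w → Walk E w v → Walk E u v

len : ∀ {V} {E : V → V → Set} {u v} → Walk E u v → ℕ
len []         = zero
len (step _ p) = suc (len p)

verts : ∀ {V} {E : V → V → Set} {u v} → Walk E u v → List V
verts {u = u} []         = u ∷ []
verts {u = u} (step _ p) = u ∷ verts p

colours : ∀ {V} {E : V → V → Set} {u v} → (V → V → ℕ) → Walk E u v → List ℕ
colours c []                   = []
colours c (step {u} {w} _ p)   = c u w ∷ colours c p

IsPath : ∀ {V} {E : V → V → Set} {u v} → Walk E u v → Set
IsPath p = Unique (verts p)

Rainbow : ∀ {V} {E : V → V → Set} {u v} → (V → V → ℕ) → Walk E u v → Set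
Rainbow c p = Unique (colours c p)

Connected : {V : Set} → (V → V → Set) → Set
Connected {V} E = V × (∀ u v → Walk E u v)

deleteEdge : ∀ {V} → Graph V → V → V → V → V → Set
deleteEdge G a b x y = Adj G x y × ¬ (x ≡ a × y ≡ b) × ¬ (x ≡ b × y ≡ a)

Bridgeless : ∀ {V} → Graph V → Set
Bridgeless G = ∀ a b → Adj G a b → Connected (deleteEdge G a b)

Induced : ∀ {V} → Graph V → (S : V → Set) → Graph (Σ V S)
Induced G S = record
  { adj    = λ x y → adj G (proj₁ x) (proj₁ y)
  ; sym    = λ x y → sym G (proj₁ x) (proj₁ y)
  ; irrefl = λ x → irrefl G (proj₁ x)
  }

_[_] : ∀ {n} → Graph (Fin n) → (D : Subset n) → Graph (Σ (Fin n) (λ i → i ∈ D))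
G [ D ] = Induced G (λ i → i ∈ D)

StepDominating : ∀ {n} → Graph (Fin n) → ℕ → Subset n → Set
StepDominating G l D =
  ∀ v → Σ[ u ∈ Fin _ ] (u ∈ D × Σ[ p ∈ Walk (Adj G) v u ] (len p ≤ l))

ConnStepDominating : ∀ {n} → Graph (Fin n) → ℕ → Subset n → Set
ConnStepDominating G l D = StepDominating G l D × Connected (Adj (G [ D ]))

-- an edge colouring (symmetric function on pairs; only values on edges
-- matter) using at most k colours (colours 0..k-1) which is a rainbow
-- colouring: every pair of vertices is joined by a rainbow path
RainbowColouring : ∀ {V} → Graph V → ℕ → Set
RainbowColouring {V} G k =
  Σ[ c ∈ (V → V → ℕ) ]
    ( (∀ u v → c u v ≡ c v u)
    × (∀ u v → Adj G u v → c u v < k)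
    × (∀ u v → Σ[ p ∈ Walk (Adj G) u v ] (IsPath p × Rainbow c p)) )

module Submission where

-- When l = 0, D is the whole vertex set. Otherwise D grows into a connected
-- (l − 1)-step dominating set D′ ⊇ D at the price of 2l + 1 new colours, and the sum of 2j + 1
-- over j = 1, …, l is l (l + 2).
--
-- For D′, take the breadth-first forest around D and split its branches (the subtrees below the
-- vertices of depth one) greedily into lower and upper ones, so that an upper branch has a lower
-- neighbour and a lower branch has only upper neighbours. Call an edge good if it goes from a
-- branch to D without being a tree edge, or to a branch of the other kind. Every upper branch has
-- a good edge to its lower neighbour; in a lower branch, the edge from its top to D is not a
-- bridge, and the walk avoiding it leaves the branch through a good edge. D′ is D together with
-- all ancestors of endpoints of good edges; it contains the top of every branch, hence dominates
-- in l − 1 steps. Tree edges at depth j are coloured K + j − 1 in lower and K + 2l + 1 − j in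
-- upper branches, good edges K + l. A vertex of D′ reaches D by two rainbow walks with colours in
-- complementary intervals: straight up its branch, and down to a good edge, across, and up the
-- other side. Joining the appropriate ones for two vertices through a rainbow path of G[D] gives
-- a rainbow walk between them.
--
-- For the bound |D| − 1, colour the tree edge above each non-root vertex of a spanning tree of
-- G[D] by that vertex's rank; tree paths are then rainbow.

open import Defs hiding (sym)
open import Data.Bool using (Bool; true; false; _∨_; _∧_; not; if_then_else_)
import Data.Bool as Bool
open import Data.Bool.Properties using (∧-conicalˡ; ∧-conicalʳ; ∨-zeroʳ; ¬-not)
open import Data.Empty using (⊥)
open import Data.Fin using (Fin; zero; suc; toℕ)
open import Data.Fin.Properties using (_≟_; any?; toℕ<n; toℕ-injective)
open import Data.Fin.Subset using (Subset; _∈_; ∣_∣; inside; outside; _-_)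
open import Data.Fin.Subset.Properties using (_∈?_; x∈p∧x≢y⇒x∈p-y; x∈p⇒∣p-x∣<∣p∣)
open import Data.List using (List; []; _∷_; _++_; map; reverse)
open import Data.List.Properties using (unfold-reverse)
open import Data.List.Membership.Propositional using () renaming (_∈_ to _∈ˡ_)
import Data.List.Membership.DecPropositional as DecMembership
open import Data.List.Relation.Binary.Sublist.Propositional using (_⊆_; []; _∷_; _∷ʳ_; ⊆-refl; ⊆-trans)
open import Data.List.Relation.Binary.Sublist.Propositional.Properties using (All-resp-⊆)
open import Data.List.Relation.Unary.All using (All; []; _∷_)
import Data.List.Relation.Unary.All as All
open import Data.List.Relation.Unary.All.Properties using (¬Any⇒All¬; ++⁺)
open import Data.List.Relation.Unary.Any using (here; there)
open import Data.List.Relation.Unary.Unique.Propositional using (Unique; []; _∷_)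
import Data.List.Relation.Unary.Unique.Propositional.Properties as Unique
open import Data.Nat using (ℕ; zero; suc; pred; _+_; _*_; _∸_; _≤_; _<_; _≤?_; _<?_; _<ᵇ_; _≤′_; ≤′-refl; ≤′-step;
                            z≤n; s≤s; s≤s⁻¹; >-nonZero)
open import Data.Nat.Properties hiding (_≟_)
open import Data.Nat.Tactic.RingSolver using (solve-∀)
open import Data.Product using (Σ; Σ-syntax; ∃; ∃₂; ∃-syntax; _×_; _,_; proj₁; proj₂)
open import Data.Sum using (_⊎_; inj₁; inj₂)
open import Data.Unit using (⊤; tt)
open import Data.Vec using (_∷_; here; there; lookup; tabulate)
open import Data.Vec.Properties using ([]=⇒lookup; lookup⇒[]=; lookup∘tabulate)
open import Data.Vec.Properties.WithK using ([]=-irrelevant)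
open import Function using (_∘′_)
open import Relation.Binary.Definitions using (DecidableEquality; Symmetric; tri<; tri≈; tri>)
open import Relation.Binary.PropositionalEquality hiding ([_])
open import Relation.Nullary using (Dec; yes; no; does; ¬_; ¬?; contradiction; _×-dec_; _⊎-dec_)
open import Relation.Nullary.Decidable using (dec-true; dec-false)
open import Relation.Unary using (Decidable)

true-or-false : ∀ b → b ≡ true ⊎ b ≡ false
true-or-false true  = inj₁ refl
true-or-false false = inj₂ refl

false⇒¬true : ∀ {b} → b ≡ false → ¬ b ≡ true
false⇒¬true refl ()

∨-trueˡ : ∀ {a} b → a ≡ true → a ∨ b ≡ true
∨-trueˡ b refl = refl

∨-trueʳ : ∀ a {b} → b ≡ true → a ∨ b ≡ true
∨-trueʳ a refl = ∨-zeroʳ a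

∧-true : ∀ {a b} → a ≡ true → b ≡ true → a ∧ b ≡ true
∧-true refl refl = refl

∧-true⁻ˡ : ∀ a {b} → a ∧ b ≡ true → a ≡ true
∧-true⁻ˡ a {b} = ∧-conicalˡ a b

∧-true⁻ʳ : ∀ a {b} → a ∧ b ≡ true → b ≡ true
∧-true⁻ʳ a {b} = ∧-conicalʳ a b

not-true⁻ : ∀ {b} → not b ≡ true → b ≡ false
not-true⁻ {false} _ = refl

not-false : ∀ {b} → b ≡ false → not b ≡ true
not-false refl = refl

does-true⁻ : ∀ {P : Set} (P? : Dec P) → does P? ≡ true → P
does-true⁻ (yes p) _ = p

does-false⁻ : ∀ {P : Set} (P? : Dec P) → does P? ≡ false → ¬ P
does-false⁻ (no ¬p) _ = ¬p

if-swap : ∀ {A : Set} p q {x y z : A} → ¬ (p ≡ true × q ≡ true) →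
          (if p then x else if q then y else z) ≡ (if q then y else if p then x else z)
if-swap true  true  both = contradiction (refl , refl) both
if-swap true  false _    = refl
if-swap false true  _    = refl
if-swap false false _    = refl

if-true : ∀ {A : Set} {b} {x y : A} → b ≡ true → (if b then x else y) ≡ x
if-true refl = refl

if-false : ∀ {A : Set} {b} {x y : A} → b ≡ false → (if b then x else y) ≡ y
if-false refl = refl

if-∧-swap : ∀ {A : Set} a b {x y X Y : A} → x ≡ y → X ≡ Y → (if a ∧ b then x else X) ≡ (if b ∧ a then y else Y)
if-∧-swap true  true  x≡y _   = x≡y
if-∧-swap true  false _   X≡Y = X≡Y
if-∧-swap false true  _   X≡Y = X≡Y
if-∧-swap false false _   X≡Y = X≡Y

sumᶠ : ∀ {n} → (Fin n → ℕ) → ℕ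
sumᶠ {zero}  f = 0
sumᶠ {suc n} f = f zero + sumᶠ (f ∘′ suc)

≤-sumᶠ : ∀ {n} (f : Fin n → ℕ) i → f i ≤ sumᶠ f
≤-sumᶠ f zero    = m≤m+n _ _
≤-sumᶠ f (suc i) = ≤-trans (≤-sumᶠ (f ∘′ suc) i) (m≤n+m _ (f zero))

<⇒≤∸1 : ∀ {m n} → m < n → m ≤ n ∸ 1
<⇒≤∸1 (s≤s m≤n) = m≤n

Unique-resp-⊆ : ∀ {A : Set} {xs ys : List A} → xs ⊆ ys → Unique ys → Unique xs
Unique-resp-⊆ []           []         = []
Unique-resp-⊆ (y ∷ʳ xs⊆ys) (_ ∷ u)    = Unique-resp-⊆ xs⊆ys u
Unique-resp-⊆ (refl ∷ xs⊆ys) (y∉ ∷ u) = All-resp-⊆ xs⊆ys y∉ ∷ Unique-resp-⊆ xs⊆ys u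

All-reverse : ∀ {A : Set} {P : A → Set} {xs} → All P xs → All P (reverse xs)
All-reverse         []                  = []
All-reverse {P = P} {x ∷ xs} (Px ∷ Pxs) =
  subst (All P) (sym (unfold-reverse x xs)) (++⁺ (All-reverse Pxs) (Px ∷ []))

Unique-reverse : ∀ {A : Set} {xs : List A} → Unique xs → Unique (reverse xs)
Unique-reverse              []         = []
Unique-reverse {xs = x ∷ xs} (x∉ ∷ u) =
  subst Unique (sym (unfold-reverse x xs))
    (Unique.++⁺ (Unique-reverse u) ([] ∷ []) λ { (x∈ , here refl) → All.lookup (All-reverse x∉) x∈ refl })

Unique-++-separated : ∀ {A : Set} {P Q : A → Set} {xs ys : List A} →
                      Unique xs → Unique ys → All P xs → All Q ys → (∀ {z} → P z → Q z → ⊥) →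
                      Unique (xs ++ ys)
Unique-++-separated uxs uys Pxs Qys PQ-disjoint =
  Unique.++⁺ uxs uys λ (z∈xs , z∈ys) → PQ-disjoint (All.lookup Pxs z∈xs) (All.lookup Qys z∈ys)

Unique-map-injectiveOn : ∀ {A B : Set} {P : A → Set} (f : A → B) →
                         (∀ {x y} → P x → P y → f x ≡ f y → x ≡ y) →
                         ∀ {xs} → All P xs → Unique xs → Unique (map f xs)
Unique-map-injectiveOn f f-inj []         []         = []
Unique-map-injectiveOn f f-inj (Px ∷ Pxs) (x∉ ∷ uxs) = fx∉ Pxs x∉ ∷ Unique-map-injectiveOn f f-inj Pxs uxs
  where
  fx∉ : ∀ {ys} → All _ ys → All _ ys → All (λ z → ¬ f _ ≡ z) (map f ys)
  fx∉ []         []           = []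
  fx∉ (Py ∷ Pys) (x≢y ∷ x∉ys) = (λ fx≡fy → x≢y (f-inj Px Py fx≡fy)) ∷ fx∉ Pys x∉ys

RainbowIn : ℕ → ℕ → List ℕ → Set
RainbowIn lo hi cs = Unique cs × All (λ c → lo ≤ c × c < hi) cs

RainbowIn-cong : ∀ {lo lo′ hi hi′ cs cs′} → lo ≡ lo′ → hi ≡ hi′ → cs ≡ cs′ →
                 RainbowIn lo hi cs → RainbowIn lo′ hi′ cs′
RainbowIn-cong refl refl refl rainbow = rainbow

RainbowIn-[] : ∀ {lo hi} → RainbowIn lo hi []
RainbowIn-[] = [] , []

RainbowIn-weaken : ∀ {lo lo′ hi hi′ cs} → lo′ ≤ lo → hi ≤ hi′ → RainbowIn lo hi cs → RainbowIn lo′ hi′ cs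
RainbowIn-weaken lo′≤lo hi≤hi′ (u , in-range) =
  u , All.map (λ (lo≤c , c<hi) → ≤-trans lo′≤lo lo≤c , <-≤-trans c<hi hi≤hi′) in-range

RainbowIn-∷-top : ∀ {lo c cs} → lo ≤ c → RainbowIn lo c cs → RainbowIn lo (suc c) (c ∷ cs)
RainbowIn-∷-top lo≤c (u , in-range) =
  All.map (λ (_ , c′<c) c≡c′ → <-irrefl (sym c≡c′) c′<c) in-range ∷ u ,
  (lo≤c , ≤-refl) ∷ All.map (λ (lo≤c′ , c′<c) → lo≤c′ , m<n⇒m<1+n c′<c) in-range

RainbowIn-∷-bottom : ∀ {c hi cs} → c < hi → RainbowIn (suc c) hi cs → RainbowIn c hi (c ∷ cs)
RainbowIn-∷-bottom c<hi (u , in-range) =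
  All.map (λ (c<c′ , _) c≡c′ → <-irrefl c≡c′ c<c′) in-range ∷ u ,
  (≤-refl , c<hi) ∷ All.map (λ (c<c′ , c′<hi) → <⇒≤ c<c′ , c′<hi) in-range

RainbowIn-++ : ∀ {a b c d xs ys} → a ≤ b → b ≤ c → c ≤ d →
               RainbowIn a b xs → RainbowIn c d ys → RainbowIn a d (xs ++ ys)
RainbowIn-++ a≤b b≤c c≤d (uxs , xs-in) (uys , ys-in) =
  Unique-++-separated uxs uys xs-in ys-in (λ (_ , z<b) (c≤z , _) → <-irrefl refl (<-≤-trans z<b (≤-trans b≤c c≤z))) ,
  ++⁺ (All.map (λ (a≤z , z<b) → a≤z , <-≤-trans z<b (≤-trans b≤c c≤d)) xs-in)
      (All.map (λ (c≤z , z<d) → ≤-trans (≤-trans a≤b b≤c) c≤z , z<d) ys-in)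

RainbowIn-++-descending : ∀ {a b c d xs ys} → a ≤ b → b ≤ c → c ≤ d →
                          RainbowIn c d xs → RainbowIn a b ys → RainbowIn a d (xs ++ ys)
RainbowIn-++-descending a≤b b≤c c≤d (uxs , xs-in) (uys , ys-in) =
  Unique-++-separated uxs uys xs-in ys-in (λ (c≤z , _) (_ , z<b) → <-irrefl refl (<-≤-trans z<b (≤-trans b≤c c≤z))) ,
  ++⁺ (All.map (λ (c≤z , z<d) → ≤-trans (≤-trans a≤b b≤c) c≤z , z<d) xs-in)
      (All.map (λ (a≤z , z<b) → a≤z , <-≤-trans z<b (≤-trans b≤c c≤d)) ys-in)

RainbowIn-reverse : ∀ {lo hi cs} → RainbowIn lo hi cs → RainbowIn lo hi (reverse cs)
RainbowIn-reverse (u , in-range) = Unique-reverse u , All-reverse in-range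

anyᵇ : ∀ {n} → (Fin n → Bool) → Bool
anyᵇ f = does (any? λ i → f i Bool.≟ true)

anyᵇ-intro : ∀ {n} (f : Fin n → Bool) i → f i ≡ true → anyᵇ f ≡ true
anyᵇ-intro f i fi = dec-true (any? _) (i , fi)

anyᵇ-elim : ∀ {n} (f : Fin n → Bool) → anyᵇ f ≡ true → ∃ λ i → f i ≡ true
anyᵇ-elim f = does-true⁻ (any? _)

anyᵇ-cong : ∀ {n} {f g : Fin n → Bool} → (∀ i → f i ≡ g i) → anyᵇ f ≡ anyᵇ g
anyᵇ-cong {f = f} {g} f≗g with true-or-false (anyᵇ f)
... | inj₁ any-f = let (i , fi) = anyᵇ-elim f any-f in
                   trans any-f (sym (anyᵇ-intro g i (trans (sym (f≗g i)) fi)))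
... | inj₂ no-f  = trans no-f (sym (dec-false (any? _) λ (i , gi) →
                     false⇒¬true no-f (anyᵇ-intro f i (trans (f≗g i) gi))))

pick : ∀ {n} → (Fin n → Bool) → Fin n → Fin n
pick f d with any? (λ i → f i Bool.≟ true)
... | yes (i , _) = i
... | no _        = d

pick-spec : ∀ {n} (f : Fin n → Bool) d → anyᵇ f ≡ true → f (pick f d) ≡ true
pick-spec f d any-f with any? (λ i → f i Bool.≟ true)
... | yes (i , fi) = fi

AllEdges : ∀ {V : Set} {E : V → V → Set} → (V → V → Set) → ∀ {u v} → Walk E u v → Set
AllEdges P []                 = ⊤
AllEdges P (step {u} {w} e p) = P u w × AllEdges P p

module _ {V : Set} {E : V → V → Set} where

  infixr 5 _++ʷ_
  _++ʷ_ : ∀ {u v w} → Walk E u v → Walk E v w → Walk E u w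
  []       ++ʷ q = q
  step e p ++ʷ q = step e (p ++ʷ q)

  colours-++ʷ : (c : V → V → ℕ) → ∀ {u v w} (p : Walk E u v) (q : Walk E v w) →
                colours c (p ++ʷ q) ≡ colours c p ++ colours c q
  colours-++ʷ c []         q = refl
  colours-++ʷ c (step e p) q = cong (_ ∷_) (colours-++ʷ c p q)

  All-verts-++ʷ : ∀ {P : V → Set} {u v w} (p : Walk E u v) (q : Walk E v w) →
                  All P (verts p) → All P (verts q) → All P (verts (p ++ʷ q))
  All-verts-++ʷ []         q _        Pq = Pq
  All-verts-++ʷ (step e p) q (Pu ∷ Pp) Pq = Pu ∷ All-verts-++ʷ p q Pp Pq

  All-verts-head : ∀ {P : V → Set} {u v} (p : Walk E u v) → All P (verts p) → P u
  All-verts-head []         (Pu ∷ _) = Pu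
  All-verts-head (step e p) (Pu ∷ _) = Pu

  AllEdges-++ʷ : ∀ {P : V → V → Set} {u v w} (p : Walk E u v) (q : Walk E v w) →
                 AllEdges P p → AllEdges P q → AllEdges P (p ++ʷ q)
  AllEdges-++ʷ []         q _          Pq = Pq
  AllEdges-++ʷ (step e p) q (Pe , Pp) Pq = Pe , AllEdges-++ʷ p q Pp Pq

  All-colours : ∀ {P : ℕ → Set} (c : V → V → ℕ) → (∀ {x y} → E x y → P (c x y)) →
                ∀ {u v} (p : Walk E u v) → All P (colours c p)
  All-colours c P-edge []         = []
  All-colours c P-edge (step e p) = P-edge e ∷ All-colours c P-edge p

  mapʷ : ∀ {F : V → V → Set} → (∀ {x y} → E x y → F x y) → ∀ {u v} → Walk E u v → Walk F u v
  mapʷ f []         = []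
  mapʷ f (step e p) = step (f e) (mapʷ f p)

  verts-mapʷ : ∀ {F : V → V → Set} (f : ∀ {x y} → E x y → F x y) → ∀ {u v} (p : Walk E u v) →
               verts (mapʷ f p) ≡ verts p
  verts-mapʷ f []         = refl
  verts-mapʷ f (step e p) = cong (_ ∷_) (verts-mapʷ f p)

  AllEdges-mapʷ : ∀ {F : V → V → Set} {P : V → V → Set} (f : ∀ {x y} → E x y → F x y) →
                  ∀ {u v} (p : Walk E u v) → AllEdges P p → AllEdges P (mapʷ f p)
  AllEdges-mapʷ f []         Pp        = Pp
  AllEdges-mapʷ f (step e p) (Pe , Pp) = Pe , AllEdges-mapʷ f p Pp

  AllEdges-map : ∀ {P Q : V → V → Set} → (∀ {x y} → E x y → P x y → Q x y) →
                 ∀ {u v} (p : Walk E u v) → AllEdges P p → AllEdges Q p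
  AllEdges-map P⇒Q []         _         = tt
  AllEdges-map P⇒Q (step e p) (Pe , Pp) = P⇒Q e Pe , AllEdges-map P⇒Q p Pp

  All-verts-subst : ∀ {P : V → Set} {u v v′} (v≡v′ : v ≡ v′) (p : Walk E u v) →
                    All P (verts p) → All P (verts (subst (Walk E u) v≡v′ p))
  All-verts-subst refl p Pp = Pp

  AllEdges-subst : ∀ {P : V → V → Set} {u v v′} (v≡v′ : v ≡ v′) (p : Walk E u v) →
                   AllEdges P p → AllEdges P (subst (Walk E u) v≡v′ p)
  AllEdges-subst refl p Pp = Pp

  leavingEdge : ∀ {P : V → Set} → Decidable P → ∀ {u v} → Walk E u v → P u → ¬ P v →
         ∃₂ λ x y → E x y × P x × ¬ P y
  leavingEdge P? []                 Pu ¬Pv = contradiction Pu ¬Pv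
  leavingEdge P? (step {w = w} e p) Pu ¬Pv with P? w
  ... | yes Pw  = leavingEdge P? p Pw ¬Pv
  ... | no  ¬Pw = _ , w , e , Pu , ¬Pw

  len≡0⇒colours≡[] : (c : V → V → ℕ) → ∀ {u v} (p : Walk E u v) → len p ≡ 0 → colours c p ≡ []
  len≡0⇒colours≡[] c [] _ = refl

  module _ (E-sym : Symmetric E) where

    reverseʷ : ∀ {u v} → Walk E u v → Walk E v u
    reverseʷ []         = []
    reverseʷ (step e p) = reverseʷ p ++ʷ step (E-sym e) []

    colours-reverseʷ : (c : V → V → ℕ) → (∀ x y → c x y ≡ c y x) →
                       ∀ {u v} (p : Walk E u v) → colours c (reverseʷ p) ≡ reverse (colours c p)
    colours-reverseʷ c c-sym []                 = refl
    colours-reverseʷ c c-sym (step {u} {w} e p) = begin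
      colours c (reverseʷ p ++ʷ step (E-sym e) [])  ≡⟨ colours-++ʷ c (reverseʷ p) _ ⟩
      colours c (reverseʷ p) ++ c w u ∷ []          ≡⟨ cong₂ (λ cs x → cs ++ x ∷ [])
                                                              (colours-reverseʷ c c-sym p) (c-sym w u) ⟩
      reverse (colours c p) ++ c u w ∷ []           ≡⟨ unfold-reverse (c u w) (colours c p) ⟨
      reverse (c u w ∷ colours c p)                 ∎
      where open ≡-Reasoning

    All-verts-reverseʷ : ∀ {P : V → Set} {u v} (p : Walk E u v) →
                         All P (verts p) → All P (verts (reverseʷ p))
    All-verts-reverseʷ []         Pp        = Pp
    All-verts-reverseʷ (step e p) (Pu ∷ Pp) =
      All-verts-++ʷ (reverseʷ p) _ (All-verts-reverseʷ p Pp) (All-verts-head p Pp ∷ Pu ∷ [])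

    AllEdges-reverseʷ : ∀ {P : V → V → Set} → Symmetric P →
                        ∀ {u v} (p : Walk E u v) → AllEdges P p → AllEdges P (reverseʷ p)
    AllEdges-reverseʷ P-sym []         _         = tt
    AllEdges-reverseʷ P-sym (step e p) (Pe , Pp) =
      AllEdges-++ʷ (reverseʷ p) _ (AllEdges-reverseʷ P-sym p Pp) (P-sym Pe , tt)

module Shortcut {V : Set} {E : V → V → Set} (_≟_ : DecidableEquality V) where
  open DecMembership _≟_ using () renaming (_∈?_ to _∈ˡ?_)

  dropUntil : ∀ {u v} (x : V) (p : Walk E u v) → x ∈ˡ verts p → Walk E x v
  dropUntil x []         (here refl) = []
  dropUntil x (step e p) (here refl) = step e p
  dropUntil x (step e p) (there x∈) = dropUntil x p x∈

  module _ (x : V) where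

    dropUntil-IsPath : ∀ {u v} (p : Walk E u v) (x∈ : x ∈ˡ verts p) → IsPath p → IsPath (dropUntil x p x∈)
    dropUntil-IsPath []         (here refl) u = u
    dropUntil-IsPath (step e p) (here refl) u = u
    dropUntil-IsPath (step e p) (there x∈) (_ ∷ u) = dropUntil-IsPath p x∈ u

    colours-dropUntil : (c : V → V → ℕ) → ∀ {u v} (p : Walk E u v) (x∈ : x ∈ˡ verts p) →
                        colours c (dropUntil x p x∈) ⊆ colours c p
    colours-dropUntil c []         (here refl) = []
    colours-dropUntil c (step e p) (here refl) = ⊆-refl
    colours-dropUntil c (step e p) (there x∈) = _ ∷ʳ colours-dropUntil c p x∈

    All-verts-dropUntil : ∀ {P : V → Set} {u v} (p : Walk E u v) (x∈ : x ∈ˡ verts p) →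
                          All P (verts p) → All P (verts (dropUntil x p x∈))
    All-verts-dropUntil []         (here refl) Pp       = Pp
    All-verts-dropUntil (step e p) (here refl) Pp       = Pp
    All-verts-dropUntil (step e p) (there x∈) (_ ∷ Pp) = All-verts-dropUntil p x∈ Pp

    AllEdges-dropUntil : ∀ {P : V → V → Set} {u v} (p : Walk E u v) (x∈ : x ∈ˡ verts p) →
                         AllEdges P p → AllEdges P (dropUntil x p x∈)
    AllEdges-dropUntil []         (here refl) Pp       = Pp
    AllEdges-dropUntil (step e p) (here refl) Pp       = Pp
    AllEdges-dropUntil (step e p) (there x∈) (_ , Pp) = AllEdges-dropUntil p x∈ Pp

  shortcut : ∀ {u v} → Walk E u v → Walk E u v
  shortcut []             = []
  shortcut (step {u} e p) with u ∈ˡ? verts (shortcut p)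
  ... | yes u∈ = dropUntil u (shortcut p) u∈
  ... | no _   = step e (shortcut p)

  shortcut-IsPath : ∀ {u v} (p : Walk E u v) → IsPath (shortcut p)
  shortcut-IsPath []             = [] ∷ []
  shortcut-IsPath (step {u} e p) with u ∈ˡ? verts (shortcut p)
  ... | yes u∈ = dropUntil-IsPath u (shortcut p) u∈ (shortcut-IsPath p)
  ... | no u∉  = ¬Any⇒All¬ _ u∉ ∷ shortcut-IsPath p

  colours-shortcut : (c : V → V → ℕ) → ∀ {u v} (p : Walk E u v) → colours c (shortcut p) ⊆ colours c p
  colours-shortcut c []             = []
  colours-shortcut c (step {u} e p) with u ∈ˡ? verts (shortcut p)
  ... | yes u∈ = _ ∷ʳ ⊆-trans (colours-dropUntil u c (shortcut p) u∈) (colours-shortcut c p)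
  ... | no _   = refl ∷ colours-shortcut c p

  All-verts-shortcut : ∀ {P : V → Set} {u v} (p : Walk E u v) → All P (verts p) → All P (verts (shortcut p))
  All-verts-shortcut []             Pp        = Pp
  All-verts-shortcut (step {u} e p) (Pu ∷ Pp) with u ∈ˡ? verts (shortcut p)
  ... | yes u∈ = All-verts-dropUntil u (shortcut p) u∈ (All-verts-shortcut p Pp)
  ... | no _   = Pu ∷ All-verts-shortcut p Pp

  AllEdges-shortcut : ∀ {P : V → V → Set} {u v} (p : Walk E u v) → AllEdges P p → AllEdges P (shortcut p)
  AllEdges-shortcut []             Pp        = Pp
  AllEdges-shortcut (step {u} e p) (Pe , Pp) with u ∈ˡ? verts (shortcut p)
  ... | yes u∈ = AllEdges-dropUntil u (shortcut p) u∈ (AllEdges-shortcut p Pp)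
  ... | no _   = Pe , AllEdges-shortcut p Pp

  Rainbow-shortcut : (c : V → V → ℕ) → ∀ {u v} (p : Walk E u v) → Rainbow c p → Rainbow c (shortcut p)
  Rainbow-shortcut c p = Unique-resp-⊆ (colours-shortcut c p)

rainbowWalks⇒RainbowColouring : ∀ {V : Set} → DecidableEquality V → (G : Graph V) (K : ℕ) (c : V → V → ℕ) →
                                (∀ u v → c u v ≡ c v u) → (∀ u v → Adj G u v → c u v < K) →
                                (∀ u v → Σ[ p ∈ Walk (Adj G) u v ] Rainbow c p) →
                                RainbowColouring G K
rainbowWalks⇒RainbowColouring _≟_ G K c c-sym c-< walk =
  c , c-sym , c-< , λ u v → let (p , rainbow) = walk u v in
                            shortcut p , shortcut-IsPath p , Rainbow-shortcut c p rainbow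
  where open Shortcut {E = Adj G} _≟_

RainbowColouring⇒Connected : ∀ {V : Set} {G : Graph V} {k} → V → RainbowColouring G k → Connected (Adj G)
RainbowColouring⇒Connected v (_ , _ , _ , path) = v , λ x y → proj₁ (path x y)

Adj-sym : ∀ {V} (G : Graph V) → Symmetric (Adj G)
Adj-sym G {x} {y} = trans (Graph.sym G y x)

module Induced {n} (G : Graph (Fin n)) (D : Subset n) where

  Vertex : Set
  Vertex = Σ (Fin n) (_∈ D)

  restrict : (Fin n → Fin n → ℕ) → Vertex → Vertex → ℕ
  restrict c a b = c (proj₁ a) (proj₁ b)

  extend : (Vertex → Vertex → ℕ) → Fin n → Fin n → ℕ
  extend c u v with u ∈? D | v ∈? D
  ... | yes u∈D | yes v∈D = c (u , u∈D) (v , v∈D)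
  ... | _       | _       = 0

  restrict-extend : (c : Vertex → Vertex → ℕ) → ∀ a b → restrict (extend c) a b ≡ c a b
  restrict-extend c (u , u∈D) (v , v∈D) with u ∈? D | v ∈? D
  ... | yes u∈D′ | yes v∈D′ rewrite []=-irrelevant u∈D u∈D′ | []=-irrelevant v∈D v∈D′ = refl
  ... | no u∉D   | _        = contradiction u∈D u∉D
  ... | yes _    | no v∉D   = contradiction v∈D v∉D

  extend-sym : (c : Vertex → Vertex → ℕ) → (∀ a b → c a b ≡ c b a) → ∀ u v → extend c u v ≡ extend c v u
  extend-sym c c-sym u v with u ∈? D | v ∈? D
  ... | yes _ | yes _ = c-sym _ _
  ... | yes _ | no  _ = refl
  ... | no  _ | yes _ = refl
  ... | no  _ | no  _ = refl

  lower : ∀ {a b} → Walk (Adj (G [ D ])) a b → Walk (Adj G) (proj₁ a) (proj₁ b)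
  lower []         = []
  lower (step e p) = step e (lower p)

  All-verts-lower : ∀ {a b} (p : Walk (Adj (G [ D ])) a b) → All (_∈ D) (verts (lower p))
  All-verts-lower {a} []         = proj₂ a ∷ []
  All-verts-lower {a} (step e p) = proj₂ a ∷ All-verts-lower p

  colours-lower : (c : Fin n → Fin n → ℕ) (cD : Vertex → Vertex → ℕ) → (∀ a b → restrict c a b ≡ cD a b) →
                  ∀ {a b} (p : Walk (Adj (G [ D ])) a b) → colours c (lower p) ≡ colours cD p
  colours-lower c cD c≗cD []                 = refl
  colours-lower c cD c≗cD (step {a} {w} e p) = cong₂ _∷_ (c≗cD a w) (colours-lower c cD c≗cD p)

  lift : ∀ {u v} (u∈D : u ∈ D) (v∈D : v ∈ D) (p : Walk (Adj G) u v) → All (_∈ D) (verts p) →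
         Walk (Adj (G [ D ])) (u , u∈D) (v , v∈D)
  lift u∈D v∈D [] _ with []=-irrelevant u∈D v∈D
  ... | refl = []
  lift u∈D v∈D (step e p) (_ ∷ Dp) = step e (lift (All-verts-head p Dp) v∈D p Dp)

  verts-lift : ∀ {u v} (u∈D : u ∈ D) (v∈D : v ∈ D) (p : Walk (Adj G) u v) (Dp : All (_∈ D) (verts p)) →
               map proj₁ (verts (lift u∈D v∈D p Dp)) ≡ verts p
  verts-lift u∈D v∈D [] _ with []=-irrelevant u∈D v∈D
  ... | refl = refl
  verts-lift u∈D v∈D (step e p) (_ ∷ Dp) = cong (_ ∷_) (verts-lift _ v∈D p Dp)

  colours-lift : (c : Fin n → Fin n → ℕ) → ∀ {u v} (u∈D : u ∈ D) (v∈D : v ∈ D) (p : Walk (Adj G) u v)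
                 (Dp : All (_∈ D) (verts p)) → colours (restrict c) (lift u∈D v∈D p Dp) ≡ colours c p
  colours-lift c u∈D v∈D [] _ with []=-irrelevant u∈D v∈D
  ... | refl = refl
  colours-lift c u∈D v∈D (step e p) (_ ∷ Dp) = cong (_ ∷_) (colours-lift c _ v∈D p Dp)

  RainbowColouring-spanning : ∀ {k} → (∀ v → v ∈ D) → RainbowColouring (G [ D ]) k → RainbowColouring G k
  RainbowColouring-spanning {k} everywhere (c , c-sym , c-< , path) =
    rainbowWalks⇒RainbowColouring _≟_ G k (extend c) (extend-sym c c-sym) extend-< walk
    where
    extend-< : ∀ u v → Adj G u v → extend c u v < k
    extend-< u v uv = subst (_< k) (sym (restrict-extend c (u , everywhere u) (v , everywhere v))) (c-< _ _ uv)
    walk : ∀ u v → Σ[ p ∈ Walk (Adj G) u v ] Rainbow (extend c) p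
    walk u v = let (p , _ , rainbow) = path (u , everywhere u) (v , everywhere v) in
               lower p , subst Unique (sym (colours-lower (extend c) c (restrict-extend c) p)) rainbow

  rainbowWalksInside⇒RainbowColouring :
    (K : ℕ) (c : Fin n → Fin n → ℕ) → (∀ u v → c u v ≡ c v u) →
    (∀ {u v} → u ∈ D → v ∈ D → Adj G u v → c u v < K) →
    (∀ {u v} → u ∈ D → v ∈ D → Σ[ p ∈ Walk (Adj G) u v ] (All (_∈ D) (verts p) × Rainbow c p)) →
    RainbowColouring (G [ D ]) K
  rainbowWalksInside⇒RainbowColouring K c c-sym c-< walk =
    restrict c , (λ a b → c-sym (proj₁ a) (proj₁ b)) , (λ a b → c-< (proj₂ a) (proj₂ b)) , path
    where
    open Shortcut {E = Adj G} _≟_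
    path : ∀ a b → Σ[ p ∈ Walk (Adj (G [ D ])) a b ] (IsPath p × Rainbow (restrict c) p)
    path (u , u∈D) (v , v∈D) =
      let (p , Dp , rainbow) = walk u∈D v∈D
          Dq = All-verts-shortcut p Dp
          q  = lift u∈D v∈D (shortcut p) Dq
      in q , Unique.map⁻ (subst Unique (sym (verts-lift u∈D v∈D (shortcut p) Dq)) (shortcut-IsPath p))
           , subst Unique (sym (colours-lift c u∈D v∈D (shortcut p) Dq)) (Rainbow-shortcut c p rainbow)

module Layering {n : ℕ} (A : Fin n → Fin n → Bool) (R : Fin n → Bool) (L : ℕ) where

  Edge : Fin n → Fin n → Set
  Edge x y = A x y ≡ true

  reach : ℕ → Fin n → Bool
  reach zero    v = R v
  reach (suc i) v = reach i v ∨ anyᵇ (λ u → A v u ∧ reach i u)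

  reach-mono′ : ∀ {i j} v → i ≤′ j → reach i v ≡ true → reach j v ≡ true
  reach-mono′ v ≤′-refl        r = r
  reach-mono′ v (≤′-step i≤′j) r = ∨-trueˡ _ (reach-mono′ v i≤′j r)

  reach-mono : ∀ {i j} v → i ≤ j → reach i v ≡ true → reach j v ≡ true
  reach-mono v i≤j = reach-mono′ v (≤⇒≤′ i≤j)

  reach-step : ∀ j {v u} → A v u ≡ true → reach j u ≡ true → reach (suc j) v ≡ true
  reach-step j {v} {u} vu r = ∨-trueʳ (reach j v) (anyᵇ-intro _ u (∧-true vu r))

  reach-walk : ∀ {v u} (p : Walk Edge v u) → R u ≡ true → reach (len p) v ≡ true
  reach-walk []         Ru = Ru
  reach-walk (step e p) Ru = reach-step (len p) e (reach-walk p Ru)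

  -- the first of i, i+1, …, i+f at which v is reached, or i+f if there is none
  search : ℕ → ℕ → Fin n → ℕ
  search i zero    v = i
  search i (suc f) v = if reach i v then i else search (suc i) f v

  search-reach : ∀ i f v → reach (i + f) v ≡ true → reach (search i f v) v ≡ true
  search-reach i zero    v r rewrite +-identityʳ i = r
  search-reach i (suc f) v r with reach i v in ri
  ... | true  = ri
  ... | false = search-reach (suc i) f v (subst (λ k → reach k v ≡ true) (+-suc i f) r)

  search-≤ : ∀ i f v → search i f v ≤ i + f
  search-≤ i zero    v = m≤m+n i 0
  search-≤ i (suc f) v with reach i v
  ... | true  = m≤m+n i (suc f)
  ... | false = subst (search (suc i) f v ≤_) (sym (+-suc i f)) (search-≤ (suc i) f v)

  search-minimal : ∀ i f v {j} → i ≤ j → reach j v ≡ true → search i f v ≤ j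
  search-minimal i zero    v i≤j r = i≤j
  search-minimal i (suc f) v i≤j r with reach i v in ri
  ... | true  = i≤j
  ... | false with m≤n⇒m<n∨m≡n i≤j
  ...   | inj₁ i<j  = search-minimal (suc i) f v i<j r
  ...   | inj₂ refl = contradiction r (false⇒¬true ri)

  depth : Fin n → ℕ
  depth = search 0 L

  Reachable : Fin n → Set
  Reachable v = reach L v ≡ true

  reach-depth : ∀ {v} → Reachable v → reach (depth v) v ≡ true
  reach-depth = search-reach 0 L _

  depth-≤ : ∀ v → depth v ≤ L
  depth-≤ = search-≤ 0 L

  depth-minimal : ∀ {v j} → reach j v ≡ true → depth v ≤ j
  depth-minimal = search-minimal 0 L _ z≤n

  reach⇒Reachable : ∀ {v j} → j ≤ L → reach j v ≡ true → Reachable v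
  reach⇒Reachable = reach-mono _

  depth≡0⇒root : ∀ {v} → Reachable v → depth v ≡ 0 → R v ≡ true
  depth≡0⇒root {v} rv d≡0 = subst (λ k → reach k v ≡ true) d≡0 (reach-depth rv)

  root⇒depth≡0 : ∀ {v} → R v ≡ true → depth v ≡ 0
  root⇒depth≡0 Rv = n≤0⇒n≡0 (depth-minimal Rv)

  depth>0⇒nonroot : ∀ {v} → 0 < depth v → R v ≡ false
  depth>0⇒nonroot {v} 0<d with true-or-false (R v)
  ... | inj₁ Rv  = contradiction (root⇒depth≡0 Rv) (>⇒≢ 0<d)
  ... | inj₂ ¬Rv = ¬Rv

  nonroot⇒depth>0 : ∀ {v} → R v ≡ false → Reachable v → 0 < depth v
  nonroot⇒depth>0 {v} ¬Rv rv with depth v in d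
  ... | zero  = contradiction (depth≡0⇒root rv d) (false⇒¬true ¬Rv)
  ... | suc _ = s≤s z≤n

  parent : Fin n → Fin n
  parent v = if R v then v else pick (λ u → A v u ∧ reach (pred (depth v)) u) v

  parent-root : ∀ {v} → R v ≡ true → parent v ≡ v
  parent-root Rv rewrite Rv = refl

  -- A non-root at depth j+1 is not reached in j steps, so one of its neighbours is.
  neighbour-reached : ∀ {v} → R v ≡ false → Reachable v →
                      anyᵇ (λ u → A v u ∧ reach (pred (depth v)) u) ≡ true
  neighbour-reached {v} ¬Rv rv with depth v in d
  ... | zero  = contradiction (depth≡0⇒root rv d) (false⇒¬true ¬Rv)
  ... | suc j with reach j v in rj
  ...   | true  = contradiction (subst (_≤ j) d (depth-minimal rj)) 1+n≰n
  ...   | false = subst (λ b → b ∨ anyᵇ (λ u → A v u ∧ reach j u) ≡ true) rj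
                          (subst (λ k → reach k v ≡ true) d (reach-depth rv))

  parent-spec : ∀ {v} → R v ≡ false → Reachable v →
                A v (parent v) ≡ true × reach (pred (depth v)) (parent v) ≡ true
  parent-spec {v} ¬Rv rv rewrite ¬Rv = ∧-true⁻ˡ _ chosen , ∧-true⁻ʳ (A v _) chosen
    where chosen = pick-spec _ v (neighbour-reached ¬Rv rv)

  parent-Edge : ∀ {v} → R v ≡ false → Reachable v → Edge v (parent v)
  parent-Edge ¬Rv rv = proj₁ (parent-spec ¬Rv rv)

  parent-Reachable : ∀ {v} → Reachable v → Reachable (parent v)
  parent-Reachable {v} rv with true-or-false (R v)
  ... | inj₁ Rv  = subst Reachable (sym (parent-root Rv)) rv
  ... | inj₂ ¬Rv = reach⇒Reachable (≤-trans pred[n]≤n (depth-≤ v)) (proj₂ (parent-spec ¬Rv rv))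

  suc-pred-depth : ∀ {v} → R v ≡ false → Reachable v → suc (pred (depth v)) ≡ depth v
  suc-pred-depth {v} ¬Rv rv = suc-pred (depth v) {{>-nonZero (nonroot⇒depth>0 ¬Rv rv)}}

  depth-parent : ∀ {v} → R v ≡ false → Reachable v → depth v ≡ suc (depth (parent v))
  depth-parent {v} ¬Rv rv = ≤-antisym upper lower
    where
    upper : depth v ≤ suc (depth (parent v))
    upper = depth-minimal (reach-step (depth (parent v)) (parent-Edge ¬Rv rv) (reach-depth (parent-Reachable rv)))
    lower : suc (depth (parent v)) ≤ depth v
    lower = subst (suc (depth (parent v)) ≤_) (suc-pred-depth ¬Rv rv)
                  (s≤s (depth-minimal (proj₂ (parent-spec ¬Rv rv))))

  <depth⇒nonroot : ∀ {i v} → i < depth v → R v ≡ false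
  <depth⇒nonroot i<d = depth>0⇒nonroot (m<n⇒0<n i<d)

  <depth⇒≤depth-parent : ∀ {i v} → suc i ≤ depth v → Reachable v → i ≤ depth (parent v)
  <depth⇒≤depth-parent i<d rv = s≤s⁻¹ (subst (_ ≤_) (depth-parent (<depth⇒nonroot i<d) rv) i<d)

  parent^ : ℕ → Fin n → Fin n
  parent^ zero    v = v
  parent^ (suc i) v = parent^ i (parent v)

  parent^-suc : ∀ i v → parent^ (suc i) v ≡ parent (parent^ i v)
  parent^-suc zero    v = refl
  parent^-suc (suc i) v = parent^-suc i (parent v)

  parent^-Reachable : ∀ i {v} → Reachable v → Reachable (parent^ i v)
  parent^-Reachable zero    rv = rv
  parent^-Reachable (suc i) rv = parent^-Reachable i (parent-Reachable rv)

  depth-parent^ : ∀ i {v} → Reachable v → i ≤ depth v → depth (parent^ i v) + i ≡ depth v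
  depth-parent^ zero    rv _   = +-identityʳ _
  depth-parent^ (suc i) {v} rv i<d = begin
    depth (parent^ i (parent v)) + suc i  ≡⟨ +-suc _ i ⟩
    suc (depth (parent^ i (parent v)) + i) ≡⟨ cong suc (depth-parent^ i (parent-Reachable rv)
                                                                       (<depth⇒≤depth-parent i<d rv)) ⟩
    suc (depth (parent v))                 ≡⟨ depth-parent (<depth⇒nonroot i<d) rv ⟨
    depth v                                ∎
    where open ≡-Reasoning

  climb : ∀ i w → i ≤ depth w → Reachable w → Walk Edge w (parent^ i w)
  climb zero    w _   _  = []
  climb (suc i) w i<d rw =
    step (parent-Edge (<depth⇒nonroot i<d) rw)
         (climb i (parent w) (<depth⇒≤depth-parent i<d rw) (parent-Reachable rw))

  len-climb : ∀ i w i≤d rw → len (climb i w i≤d rw) ≡ i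
  len-climb zero    w _ _ = refl
  len-climb (suc i) w _ _ = cong suc (len-climb i (parent w) _ _)

  All-verts-climb : ∀ {P : Fin n → Set} → (∀ {x} → R x ≡ false → P x → P (parent x)) →
                    ∀ i w i≤d rw → P w → All P (verts (climb i w i≤d rw))
  All-verts-climb P-parent zero    w _   _ Pw = Pw ∷ []
  All-verts-climb P-parent (suc i) w i<d _ Pw =
    Pw ∷ All-verts-climb P-parent i (parent w) _ _ (P-parent (<depth⇒nonroot i<d) Pw)

  AllEdges-climb : ∀ i w i≤d rw → AllEdges (λ x y → R x ≡ false × parent x ≡ y) (climb i w i≤d rw)
  AllEdges-climb zero    w _   _  = tt
  AllEdges-climb (suc i) w i<d rw = (<depth⇒nonroot i<d , refl) , AllEdges-climb i (parent w) _ _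

  root : Fin n → Fin n
  root w = parent^ (depth w) w

  root-R : ∀ {w} → Reachable w → R (root w) ≡ true
  root-R {w} rw = depth≡0⇒root (parent^-Reachable (depth w) rw)
                    (+-cancelʳ-≡ (depth w) _ 0 (depth-parent^ (depth w) rw ≤-refl))

  toRoot : ∀ w → Reachable w → Walk Edge w (root w)
  toRoot w rw = climb (depth w) w ≤-refl rw

  -- the ancestor of v at depth one, which identifies the branch of the forest containing v
  top : Fin n → Fin n
  top v = parent^ (pred (depth v)) v

  depth-top : ∀ {v} → R v ≡ false → Reachable v → depth (top v) ≡ 1
  depth-top {v} ¬Rv rv = +-cancelʳ-≡ (pred (depth v)) _ 1
    (trans (depth-parent^ (pred (depth v)) rv pred[n]≤n) (sym (suc-pred-depth ¬Rv rv)))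

  top-parent : ∀ {v} → R v ≡ false → Reachable v → R (parent v) ≡ false → top (parent v) ≡ top v
  top-parent {v} ¬Rv rv ¬Rpv = cong (λ k → parent^ k v) (begin
    suc (pred (depth (parent v))) ≡⟨ suc-pred-depth ¬Rpv (parent-Reachable rv) ⟩
    depth (parent v)              ≡⟨ cong pred (depth-parent ¬Rv rv) ⟨
    pred (depth v)                ∎)
    where open ≡-Reasoning

  top-self : ∀ {v} → depth v ≡ 1 → top v ≡ v
  top-self d≡1 rewrite d≡1 = refl

  -- v is a non-root ancestor of w (or w itself)
  Ancestor : Fin n → Fin n → Set
  Ancestor v w = ∃[ i ] i < depth w × parent^ i w ≡ v

  ancestor? : ∀ v w → Dec (Ancestor v w)
  ancestor? v w = anyUpTo? (λ i → parent^ i w ≟ v) (depth w)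

  Ancestor-depth : ∀ {v w} → Reachable w → ((i , _) : Ancestor v w) → depth v + i ≡ depth w
  Ancestor-depth rw (i , i<d , refl) = depth-parent^ i rw (<⇒≤ i<d)

  Ancestor-nonroot : ∀ {v w} → Reachable w → Ancestor v w → R v ≡ false
  Ancestor-nonroot {v} rw a@(i , i<d , _) =
    depth>0⇒nonroot (+-cancelʳ-< i 0 (depth v) (subst (i <_) (sym (Ancestor-depth rw a)) i<d))

  Ancestor-top : ∀ {v w} → Reachable w → Ancestor v w → top v ≡ top w
  Ancestor-top rw (i , i<d , refl) = go i _ rw i<d
    where
    go : ∀ i w → Reachable w → i < depth w → top (parent^ i w) ≡ top w
    go zero    w rw i<d = refl
    go (suc i) w rw i<d =
      trans (go i (parent w) (parent-Reachable rw) (<depth⇒≤depth-parent i<d rw))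
            (top-parent (<depth⇒nonroot i<d) rw (<depth⇒nonroot (<depth⇒≤depth-parent i<d rw)))

  Ancestor-self : ∀ {w} → R w ≡ false → Reachable w → Ancestor w w
  Ancestor-self ¬Rw rw = 0 , nonroot⇒depth>0 ¬Rw rw , refl

  Ancestor-parent : ∀ {v w} → Reachable w → Ancestor v w → R (parent v) ≡ false → Ancestor (parent v) w
  Ancestor-parent {v} {w} rw a@(i , i<d , refl) ¬Rpv = suc i , si<d , parent^-suc i w
    where
    d≡ : depth v ≡ suc (depth (parent v))
    d≡ = depth-parent (Ancestor-nonroot rw a) (parent^-Reachable i rw)
    si<d : suc i < depth w
    si<d = subst (suc i <_) (Ancestor-depth rw a)
             (subst (λ k → suc i < k + i) (sym d≡)
               (s≤s (+-monoˡ-≤ i (nonroot⇒depth>0 ¬Rpv (parent-Reachable (parent^-Reachable i rw))))))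

  top-Ancestor : ∀ {v} → R v ≡ false → Reachable v → Ancestor (top v) v
  top-Ancestor {v} ¬Rv rv = pred (depth v) , subst (pred (depth v) <_) (suc-pred-depth ¬Rv rv) ≤-refl , refl

  parent-parent≢ : ∀ {x} → R x ≡ false → Reachable x → R (parent x) ≡ false → parent (parent x) ≢ x
  parent-parent≢ {x} ¬Rx rx ¬Rpx ppx≡x = 1+n≰n (subst (suc (depth x) ≤_) (sym loop) (n≤1+n _))
    where
    loop : depth x ≡ suc (suc (depth x))
    loop = trans (depth-parent ¬Rx rx)
                 (cong suc (trans (depth-parent ¬Rpx (parent-Reachable rx)) (cong (suc ∘′ depth) ppx≡x)))

rank : ∀ {n} → Subset n → Fin n → ℕ
rank (_       ∷ p) zero    = 0
rank (inside  ∷ p) (suc i) = suc (rank p i)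
rank (outside ∷ p) (suc i) = rank p i

rank-< : ∀ {n} (p : Subset n) {i} → i ∈ p → rank p i < ∣ p ∣
rank-< (inside  ∷ p) here         = s≤s z≤n
rank-< (inside  ∷ p) (there i∈p) = s≤s (rank-< p i∈p)
rank-< (outside ∷ p) (there i∈p) = rank-< p i∈p

rank-injective : ∀ {n} (p : Subset n) {i j} → i ∈ p → j ∈ p → rank p i ≡ rank p j → i ≡ j
rank-injective (_       ∷ p) here        here        _  = refl
rank-injective (inside  ∷ p) (there i∈p) (there j∈p) eq = cong suc (rank-injective p i∈p j∈p (suc-injective eq))
rank-injective (outside ∷ p) (there i∈p) (there j∈p) eq = cong suc (rank-injective p i∈p j∈p eq)

module TreeWalks {V : Set} {E : V → V → Set} (parent : V → V) (Child : V → Set) where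

  ChildEdge : V → V → Set
  ChildEdge x y = Child x × parent x ≡ y

  TreeEdge : V → V → Set
  TreeEdge x y = ChildEdge x y ⊎ ChildEdge y x

  TreeEdge-sym : Symmetric TreeEdge
  TreeEdge-sym (inj₁ xy) = inj₂ xy
  TreeEdge-sym (inj₂ yx) = inj₁ yx

  children : ∀ {u v} (q : Walk E u v) → AllEdges TreeEdge q → List V
  children []                     _            = []
  children (step {u}     e q) (inj₁ _ , t) = u ∷ children q t
  children (step {w = w} e q) (inj₂ _ , t) = w ∷ children q t

  head∈verts : ∀ {u v} (q : Walk E u v) → u ∈ˡ verts q
  head∈verts []         = here refl
  head∈verts (step e q) = here refl

  children-on-walk : ∀ {u v} (q : Walk E u v) (t : AllEdges TreeEdge q) →
                     All (λ x → x ∈ˡ verts q × parent x ∈ˡ verts q) (children q t)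
  children-on-walk []         _ = []
  children-on-walk (step e q) (inj₁ (_ , refl) , t) =
    (here refl , there (head∈verts q)) ∷ All.map (λ (x∈ , px∈) → there x∈ , there px∈) (children-on-walk q t)
  children-on-walk (step e q) (inj₂ (_ , refl) , t) =
    (there (head∈verts q) , here refl) ∷ All.map (λ (x∈ , px∈) → there x∈ , there px∈) (children-on-walk q t)

  All-Child-children : ∀ {u v} (q : Walk E u v) (t : AllEdges TreeEdge q) → All Child (children q t)
  All-Child-children []         _                 = []
  All-Child-children (step e q) (inj₁ (cx , _) , t) = cx ∷ All-Child-children q t
  All-Child-children (step e q) (inj₂ (cy , _) , t) = cy ∷ All-Child-children q t

  -- A later occurrence of the child would put it, or its parent, back on the path.
  children-Unique : ∀ {u v} (q : Walk E u v) (t : AllEdges TreeEdge q) → IsPath q → Unique (children q t)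
  children-Unique []         _ _ = []
  children-Unique (step e q) (inj₁ _ , t) (u∉q ∷ path) =
    ¬Any⇒All¬ _ (λ u∈ → All.lookup u∉q (proj₁ (All.lookup (children-on-walk q t) u∈)) refl)
    ∷ children-Unique q t path
  children-Unique (step e q) (inj₂ (_ , pw≡u) , t) (u∉q ∷ path) =
    ¬Any⇒All¬ _ (λ w∈ → All.lookup u∉q (subst (_∈ˡ verts q) pw≡u (proj₂ (All.lookup (children-on-walk q t) w∈)))
                                    refl)
    ∷ children-Unique q t path

  colours-children : (c : V → V → ℕ) (col : V → ℕ) →
                     (∀ {x y} → ChildEdge x y → c x y ≡ col x) → (∀ {x y} → ChildEdge x y → c y x ≡ col x) →
                     ∀ {u v} (q : Walk E u v) (t : AllEdges TreeEdge q) → colours c q ≡ map col (children q t)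
  colours-children c col down up []         _          = refl
  colours-children c col down up (step e q) (inj₁ xy , t) = cong₂ _∷_ (down xy) (colours-children c col down up q t)
  colours-children c col down up (step e q) (inj₂ yx , t) = cong₂ _∷_ (up yx)   (colours-children c col down up q t)

module TreeColouring {V : Set} (_≟_ : DecidableEquality V) (parent : V → V) (isChild : V → Bool)
                     (no-2-cycle : ∀ {x} → isChild x ≡ true → isChild (parent x) ≡ true → parent (parent x) ≢ x)
                     (label : V → ℕ) (default : ℕ) where

  ChildOf : V → V → Set
  ChildOf x y = isChild x ≡ true × parent x ≡ y

  isChildOf : V → V → Bool
  isChildOf x y = isChild x ∧ does (parent x ≟ y)

  isChildOf-intro : ∀ {x y} → ChildOf x y → isChildOf x y ≡ true
  isChildOf-intro (cx , px≡y) = ∧-true cx (dec-true (_ ≟ _) px≡y)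

  isChildOf-elim : ∀ {x y} → isChildOf x y ≡ true → ChildOf x y
  isChildOf-elim {x} {y} c = ∧-true⁻ˡ _ c , does-true⁻ (parent x ≟ y) (∧-true⁻ʳ (isChild x) c)

  not-mutual : ∀ u v → ¬ (isChildOf v u ≡ true × isChildOf u v ≡ true)
  not-mutual u v (vu , uv) =
    let (cv , pv≡u) = isChildOf-elim {v} vu
        (cu , pu≡v) = isChildOf-elim {u} uv
    in no-2-cycle cu (subst (λ z → isChild z ≡ true) (sym pu≡v) cv) (trans (cong parent pu≡v) pv≡u)

  colouring : V → V → ℕ
  colouring u v = if isChildOf v u then label v else if isChildOf u v then label u else default

  colouring-sym : ∀ u v → colouring u v ≡ colouring v u
  colouring-sym u v = if-swap (isChildOf v u) (isChildOf u v) (not-mutual u v)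

  colouring-child-parent : ∀ {x y} → ChildOf x y → colouring x y ≡ label x
  colouring-child-parent {x} {y} xy with true-or-false (isChildOf y x)
  ... | inj₁ yx  = contradiction (yx , isChildOf-intro xy) (not-mutual x y)
  ... | inj₂ ¬yx rewrite ¬yx | isChildOf-intro xy = refl

  colouring-parent-child : ∀ {x y} → ChildOf x y → colouring y x ≡ label x
  colouring-parent-child xy rewrite isChildOf-intro xy = refl

  colouring-other : ∀ {u v} → ¬ ChildOf v u → ¬ ChildOf u v → colouring u v ≡ default
  colouring-other {u} {v} ¬vu ¬uv with true-or-false (isChildOf v u) | true-or-false (isChildOf u v)
  ... | inj₁ vu  | _        = contradiction (isChildOf-elim vu) ¬vu
  ... | inj₂ _   | inj₁ uv  = contradiction (isChildOf-elim uv) ¬uv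
  ... | inj₂ ¬vu′ | inj₂ ¬uv′ rewrite ¬vu′ | ¬uv′ = refl

  colouring-elim : (P : ℕ → Set) → (∀ {x y} → ChildOf x y → P (label x)) → P default → ∀ u v → P (colouring u v)
  colouring-elim P P-label P-default u v with true-or-false (isChildOf v u)
  ... | inj₁ vu rewrite vu = P-label (isChildOf-elim vu)
  ... | inj₂ ¬vu rewrite ¬vu with true-or-false (isChildOf u v)
  ...   | inj₁ uv  rewrite uv  = P-label (isChildOf-elim uv)
  ...   | inj₂ ¬uv rewrite ¬uv = P-default

module SpanningTree {n} (G : Graph (Fin n)) (D : Subset n) (D-connected : Connected (Adj (G [ D ]))) where
  open Induced G D

  r : Fin n
  r = proj₁ (proj₁ D-connected)

  r∈D : r ∈ D
  r∈D = proj₂ (proj₁ D-connected)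

  InD : Fin n → Bool
  InD = lookup D

  isRoot : Fin n → Bool
  isRoot v = does (v ≟ r)

  walkToRoot : ∀ {v} (v∈D : v ∈ D) → Walk (Adj (G [ D ])) (v , v∈D) (r , r∈D)
  walkToRoot v∈D = proj₂ D-connected (_ , v∈D) (proj₁ D-connected)

  lengthToRoot : Fin n → ℕ
  lengthToRoot v with v ∈? D
  ... | yes v∈D = len (walkToRoot v∈D)
  ... | no  _   = 0

  -- the breadth-first tree of G[D] around r; the given walks bound its depth
  open Layering (λ u v → adj G u v ∧ InD u ∧ InD v) isRoot (sumᶠ lengthToRoot)

  lowerᴱ : ∀ {a b} → Walk (Adj (G [ D ])) a b → Walk Edge (proj₁ a) (proj₁ b)
  lowerᴱ []                           = []
  lowerᴱ {a} (step {w = b} e p) = step (∧-true e (∧-true ([]=⇒lookup (proj₂ a)) ([]=⇒lookup (proj₂ b)))) (lowerᴱ p)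

  len-lowerᴱ : ∀ {a b} (p : Walk (Adj (G [ D ])) a b) → len (lowerᴱ p) ≡ len p
  len-lowerᴱ []         = refl
  len-lowerᴱ (step e p) = cong suc (len-lowerᴱ p)

  len-walkToRoot-≤ : ∀ {v} (v∈D : v ∈ D) → len (walkToRoot v∈D) ≤ lengthToRoot v
  len-walkToRoot-≤ {v} v∈D with v ∈? D
  ... | yes v∈D′ rewrite []=-irrelevant v∈D v∈D′ = ≤-refl
  ... | no  v∉D  = contradiction v∈D v∉D

  Reachable-D : ∀ {v} → v ∈ D → Reachable v
  Reachable-D {v} v∈D =
    reach⇒Reachable (≤-trans (≤-reflexive (len-lowerᴱ (walkToRoot v∈D)))
                             (≤-trans (len-walkToRoot-≤ v∈D) (≤-sumᶠ lengthToRoot v)))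
                    (reach-walk (lowerᴱ (walkToRoot v∈D)) (dec-true (r ≟ r) refl))

  root≡r : ∀ {x} → x ∈ D → root x ≡ r
  root≡r x∈D = does-true⁻ (_ ≟ r) (root-R (Reachable-D x∈D))

  isChild : Fin n → Bool
  isChild x = not (isRoot x) ∧ InD x

  Child : Fin n → Set
  Child x = isChild x ≡ true

  open TreeWalks {E = Adj G} parent Child

  toTreeEdge : ∀ {x y} → Edge x y → isRoot x ≡ false × parent x ≡ y → ChildEdge x y
  toTreeEdge {x} xy (¬root , px≡y) = ∧-true (not-false ¬root) (∧-true⁻ˡ _ (∧-true⁻ʳ (adj G x _) xy)) , px≡y

  All-verts-Edge : ∀ {u v} (p : Walk Edge u v) → u ∈ D → All (_∈ D) (verts p)
  All-verts-Edge []                    u∈D = u∈D ∷ []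
  All-verts-Edge (step {u} {w} e p) u∈D =
    u∈D ∷ All-verts-Edge p (lookup⇒[]= w D (∧-true⁻ʳ (InD u) (∧-true⁻ʳ (adj G u w) e)))

  up : ∀ {x} → x ∈ D → Walk (Adj G) x r
  up {x} x∈D = subst (Walk (Adj G) x) (root≡r x∈D) (mapʷ (∧-true⁻ˡ _) (toRoot x (Reachable-D x∈D)))

  All-verts-up : ∀ {x} (x∈D : x ∈ D) → All (_∈ D) (verts (up x∈D))
  All-verts-up {x} x∈D =
    All-verts-subst (root≡r x∈D) _ (subst (All (_∈ D)) (sym (verts-mapʷ (∧-true⁻ˡ _) (toRoot x _)))
                                           (All-verts-Edge (toRoot x _) x∈D))

  AllEdges-up : ∀ {x} (x∈D : x ∈ D) → AllEdges TreeEdge (up x∈D)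
  AllEdges-up {x} x∈D =
    AllEdges-subst (root≡r x∈D) _ (AllEdges-mapʷ (∧-true⁻ˡ _) (toRoot x _)
      (AllEdges-map (λ xy child → inj₁ (toTreeEdge xy child)) (toRoot x _)
        (AllEdges-climb (depth x) x ≤-refl (Reachable-D x∈D))))

  colour-of : Fin n → ℕ
  colour-of = rank (D - r)

  Child⇒∈D-r : ∀ {x} → Child x → x ∈ D - r
  Child⇒∈D-r {x} cx = x∈p∧x≢y⇒x∈p-y (lookup⇒[]= x D (∧-true⁻ʳ (not (isRoot x)) cx))
                                     (does-false⁻ (x ≟ r) (not-true⁻ (∧-true⁻ˡ _ cx)))

  colour-of-< : ∀ {x} → Child x → colour-of x < ∣ D ∣ ∸ 1
  colour-of-< cx = <-≤-trans (rank-< (D - r) (Child⇒∈D-r cx)) (<⇒≤∸1 (x∈p⇒∣p-x∣<∣p∣ r∈D))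

  colour-of-injective : ∀ {x y} → Child x → Child y → colour-of x ≡ colour-of y → x ≡ y
  colour-of-injective cx cy = rank-injective (D - r) (Child⇒∈D-r cx) (Child⇒∈D-r cy)

  no-2-cycle : ∀ {x} → Child x → Child (parent x) → parent (parent x) ≢ x
  no-2-cycle {x} cx cpx = parent-parent≢ (not-true⁻ (∧-true⁻ˡ _ cx)) (Reachable-D (lookup⇒[]= x D (∧-true⁻ʳ _ cx)))
                                         (not-true⁻ (∧-true⁻ˡ _ cpx))

  open TreeColouring _≟_ parent isChild no-2-cycle colour-of 0

  -- an edge inside D has an endpoint other than r
  some-colour : ∀ {u v} → u ∈ D → v ∈ D → Adj G u v → 0 < ∣ D ∣ ∸ 1
  some-colour {u} {v} u∈D v∈D uv with u ≟ r
  ... | no  u≢r  = m<n⇒0<n (colour-of-< {u} (∧-true (not-false (dec-false (u ≟ r) u≢r)) ([]=⇒lookup u∈D)))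
  ... | yes refl = m<n⇒0<n (colour-of-< {v} (∧-true (not-false (dec-false (v ≟ u) v≢u)) ([]=⇒lookup v∈D)))
    where v≢u : v ≢ u
          v≢u refl = false⇒¬true (Graph.irrefl G u) uv

  colouring-< : ∀ {u v} → u ∈ D → v ∈ D → Adj G u v → colouring u v < ∣ D ∣ ∸ 1
  colouring-< {u} {v} u∈D v∈D uv =
    colouring-elim (_< ∣ D ∣ ∸ 1) (λ (cx , _) → colour-of-< cx) (some-colour u∈D v∈D uv) u v

  rainbowWalkInside : ∀ {u v} → u ∈ D → v ∈ D →
                      Σ[ p ∈ Walk (Adj G) u v ] (All (_∈ D) (verts p) × Rainbow colouring p)
  rainbowWalkInside u∈D v∈D = shortcut W , All-verts-shortcut W DW , rainbow
    where
    open Shortcut {E = Adj G} _≟_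
    W  = up u∈D ++ʷ reverseʷ (Adj-sym G) (up v∈D)
    DW = All-verts-++ʷ (up u∈D) _ (All-verts-up u∈D) (All-verts-reverseʷ (Adj-sym G) (up v∈D) (All-verts-up v∈D))
    TW : AllEdges TreeEdge W
    TW = AllEdges-++ʷ (up u∈D) _ (AllEdges-up u∈D)
                      (AllEdges-reverseʷ (Adj-sym G) TreeEdge-sym (up v∈D) (AllEdges-up v∈D))
    T  = AllEdges-shortcut W TW
    rainbow : Rainbow colouring (shortcut W)
    rainbow = subst Unique (sym (colours-children colouring colour-of colouring-child-parent colouring-parent-child
                                                  (shortcut W) T))
                (Unique-map-injectiveOn colour-of colour-of-injective (All-Child-children (shortcut W) T)
                  (children-Unique (shortcut W) T (shortcut-IsPath W)))

  rainbowColouring : RainbowColouring (G [ D ]) (∣ D ∣ ∸ 1)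
  rainbowColouring =
    rainbowWalksInside⇒RainbowColouring (∣ D ∣ ∸ 1) colouring colouring-sym colouring-< rainbowWalkInside

module Refinement {n} (G : Graph (Fin n)) (bridgeless : Bridgeless G)
                  (m : ℕ) (D : Subset n) (D-dominating : StepDominating G (suc m) D) where

  l : ℕ
  l = suc m

  InD : Fin n → Bool
  InD = lookup D

  open Layering (adj G) InD l

  reachable : ∀ v → Reachable v
  reachable v = let (u , u∈D , p , len≤l) = D-dominating v in
                reach⇒Reachable len≤l (reach-walk p ([]=⇒lookup u∈D))

  BranchesAdjacent : Fin n → Fin n → Set
  BranchesAdjacent a b = ∃₂ λ x y → (InD x ≡ false × InD y ≡ false) × (top x ≡ a × top y ≡ b) × Adj G x y

  branchesAdjacent? : ∀ a b → Dec (BranchesAdjacent a b)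
  branchesAdjacent? a b = any? λ x → any? λ y →
    ((InD x Bool.≟ false) ×-dec (InD y Bool.≟ false)) ×-dec ((top x ≟ a) ×-dec (top y ≟ b)) ×-dec
    (adj G x y Bool.≟ true)

  BranchesAdjacent-sym : ∀ {a b} → BranchesAdjacent a b → BranchesAdjacent b a
  BranchesAdjacent-sym (x , y , (¬Dx , ¬Dy) , (tx , ty) , xy) = y , x , (¬Dy , ¬Dx) , (ty , tx) , Adj-sym G xy

  -- Sides are chosen greedily in index order: a branch is on the upper side (true) iff it is
  -- adjacent to an earlier branch on the lower side.
  sideStep : (Fin n → Bool) → Fin n → Bool
  sideStep s a = anyᵇ λ b → does (toℕ b <? toℕ a) ∧ does (branchesAdjacent? a b) ∧ not (s b)

  -- iterating sideStep n times fixes the sides of all n vertices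
  side′ : ℕ → Fin n → Bool
  side′ zero    = λ _ → false
  side′ (suc k) = sideStep (side′ k)

  side : Fin n → Bool
  side = side′ n

  earlier : ∀ {a b : Fin n} → does (toℕ b <? toℕ a) ≡ true → toℕ b < toℕ a
  earlier = does-true⁻ (_ <? _)

  sideStep-cong : ∀ {s s′} a → (∀ b → toℕ b < toℕ a → s b ≡ s′ b) → sideStep s a ≡ sideStep s′ a
  sideStep-cong {s} {s′} a s≗s′ = anyᵇ-cong same
    where
    same : ∀ b → (does (toℕ b <? toℕ a) ∧ does (branchesAdjacent? a b) ∧ not (s b))
               ≡ (does (toℕ b <? toℕ a) ∧ does (branchesAdjacent? a b) ∧ not (s′ b))
    same b with toℕ b <ᵇ toℕ a in b<a
    ... | true  = cong (λ x → does (branchesAdjacent? a b) ∧ not x) (s≗s′ b (earlier b<a))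
    ... | false = refl

  side′-stable : ∀ k k′ a → toℕ a < k → toℕ a < k′ → side′ k a ≡ side′ k′ a
  side′-stable (suc k) (suc k′) a a<k a<k′ =
    sideStep-cong a λ b b<a → side′-stable k k′ b (<-≤-trans b<a (s≤s⁻¹ a<k)) (<-≤-trans b<a (s≤s⁻¹ a<k′))

  side-unfold : ∀ a → side a ≡ sideStep side a
  side-unfold a = unfold n (toℕ<n a)
    where
    unfold : ∀ k → toℕ a < k → side′ k a ≡ sideStep side a
    unfold (suc k) a<k =
      sideStep-cong a λ b b<a → side′-stable k n b (<-≤-trans b<a (s≤s⁻¹ a<k)) (<-trans b<a (toℕ<n a))

  side-true : ∀ {a} → side a ≡ true → ∃ λ b → toℕ b < toℕ a × BranchesAdjacent a b × side b ≡ false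
  side-true {a} upper =
    let (b , cond) = anyᵇ-elim _ (trans (sym (side-unfold a)) upper)
        rest = ∧-true⁻ʳ (does (toℕ b <? toℕ a)) cond
    in b , earlier (∧-true⁻ˡ _ cond)
         , does-true⁻ (branchesAdjacent? a b) (∧-true⁻ˡ _ rest)
         , not-true⁻ (∧-true⁻ʳ (does (branchesAdjacent? a b)) rest)

  side-false : ∀ {a b} → side a ≡ false → toℕ b < toℕ a → BranchesAdjacent a b → side b ≡ true
  side-false {a} {b} lower b<a adj-ab with true-or-false (side b)
  ... | inj₁ upper = upper
  ... | inj₂ lower-b = contradiction
    (trans (side-unfold a) (anyᵇ-intro _ b (∧-true (dec-true (_ <? _) b<a)
                                               (∧-true (dec-true (branchesAdjacent? a b) adj-ab) (not-false lower-b)))))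
    (false⇒¬true lower)

  adjacent-lower⇒upper : ∀ {a b} → a ≢ b → side a ≡ false → BranchesAdjacent a b → side b ≡ true
  adjacent-lower⇒upper {a} {b} a≢b lower adj-ab with <-cmp (toℕ b) (toℕ a)
  ... | tri< b<a _ _ = side-false lower b<a adj-ab
  ... | tri≈ _ b≡a _ = contradiction (sym (toℕ-injective b≡a)) a≢b
  ... | tri> _ _ a<b with true-or-false (side b)
  ...   | inj₁ upper   = upper
  ...   | inj₂ lower-b = contradiction (side-false lower-b a<b (BranchesAdjacent-sym adj-ab)) (false⇒¬true lower)

  GoodEdge : Fin n → Fin n → Set
  GoodEdge w w′ = (InD w′ ≡ true × parent w ≢ w′) ⊎ (InD w′ ≡ false × side (top w′) ≢ side (top w))

  HasGoodEdge : Fin n → Set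
  HasGoodEdge w = ∃ λ w′ → Adj G w w′ × GoodEdge w w′

  hasGoodEdge? : ∀ w → Dec (HasGoodEdge w)
  hasGoodEdge? w = any? λ w′ → (adj G w w′ Bool.≟ true) ×-dec
    (((InD w′ Bool.≟ true) ×-dec ¬? (parent w ≟ w′)) ⊎-dec
     ((InD w′ Bool.≟ false) ×-dec ¬? (side (top w′) Bool.≟ side (top w))))

  InD′ : Fin n → Set
  InD′ v = InD v ≡ true ⊎ ∃ λ w → Ancestor v w × HasGoodEdge w

  inD′? : ∀ v → Dec (InD′ v)
  inD′? v = (InD v Bool.≟ true) ⊎-dec any? (λ w → ancestor? v w ×-dec hasGoodEdge? w)

  D′ : Subset n
  D′ = tabulate (λ v → does (inD′? v))

  InD′⇒∈D′ : ∀ {v} → InD′ v → v ∈ D′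
  InD′⇒∈D′ {v} p = lookup⇒[]= v D′ (trans (lookup∘tabulate _ v) (dec-true (inD′? v) p))

  ∈D′⇒InD′ : ∀ {v} → v ∈ D′ → InD′ v
  ∈D′⇒InD′ {v} v∈D′ = does-true⁻ (inD′? v) (trans (sym (lookup∘tabulate _ v)) ([]=⇒lookup v∈D′))

  InD′-parent : ∀ {v} → InD′ v → InD′ (parent v)
  InD′-parent (inj₁ Dv) = inj₁ (subst (λ z → InD z ≡ true) (sym (parent-root Dv)) Dv)
  InD′-parent {v} (inj₂ (w , v≼w , good)) with true-or-false (InD (parent v))
  ... | inj₁ Dpv  = inj₁ Dpv
  ... | inj₂ ¬Dpv = inj₂ (w , Ancestor-parent (reachable w) v≼w ¬Dpv , good)

  upper-branch-hasGoodEdge : ∀ {a} → side a ≡ true → ∃ λ w → Ancestor a w × HasGoodEdge w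
  upper-branch-hasGoodEdge upper =
    let (b , _ , (x , y , (¬Dx , ¬Dy) , (tx≡a , ty≡b) , xy) , lower-b) = side-true upper
    in x , subst (λ z → Ancestor z x) tx≡a (top-Ancestor ¬Dx (reachable x)) ,
       y , xy , inj₂ (¬Dy , λ same → false⇒¬true lower-b
                                       (trans (sym (cong side ty≡b)) (trans same (trans (cong side tx≡a) upper))))

  InBranch : Fin n → Fin n → Set
  InBranch a x = InD x ≡ false × top x ≡ a

  -- The edge leaves the branch either back into D, and not to a's parent, or into an adjacent
  -- branch, which is then upper.
  leaving-lower-branch-GoodEdge : ∀ {a x y} → side a ≡ false → Adj G x y → ¬ (x ≡ a × y ≡ parent a) →
                                  InBranch a x → ¬ InBranch a y → GoodEdge x y
  leaving-lower-branch-GoodEdge {a} {x} {y} lower xy ≢a-pa (¬Dx , tx≡a) y∉ with true-or-false (InD y)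
  ... | inj₁ Dy  = inj₁ (Dy , λ px≡y → ≢a-pa (x≡a px≡y , trans (sym px≡y) (cong parent (x≡a px≡y))))
    where
    x≡a : parent x ≡ y → x ≡ a
    x≡a px≡y = trans (sym (top-self (trans (depth-parent ¬Dx (reachable x))
                                          (cong suc (root⇒depth≡0 (subst (λ z → InD z ≡ true) (sym px≡y) Dy))))))
                     tx≡a
  ... | inj₂ ¬Dy = inj₂ (¬Dy , λ same → false⇒¬true lower (trans (sym (cong side tx≡a)) (trans (sym same) upper-y)))
    where
    upper-y : side (top y) ≡ true
    upper-y = adjacent-lower⇒upper (λ a≡ty → y∉ (¬Dy , sym a≡ty)) lower (x , y , (¬Dx , ¬Dy) , (tx≡a , refl) , xy)

  -- G is bridgeless, so some walk from a to its parent avoids their edge; it must leave a's branch.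
  lower-branch-hasGoodEdge : ∀ {a} → depth a ≡ 1 → side a ≡ false → ∃ λ w → Ancestor a w × HasGoodEdge w
  lower-branch-hasGoodEdge {a} d≡1 lower =
    let (x , y , (xy , ≢a-pa , _) , x∈ , y∉) =
          leavingEdge inBranch? (proj₂ (bridgeless a (parent a) (parent-Edge ¬Da (reachable a))) a (parent a))
                      (¬Da , top-self d≡1) (λ (¬Dpa , _) → false⇒¬true ¬Dpa pa∈D)
    in x , subst (λ z → Ancestor z x) (proj₂ x∈) (top-Ancestor (proj₁ x∈) (reachable x)) ,
       y , xy , leaving-lower-branch-GoodEdge lower xy ≢a-pa x∈ y∉
    where
    ¬Da : InD a ≡ false
    ¬Da = depth>0⇒nonroot (subst (0 <_) (sym d≡1) (s≤s z≤n))
    pa∈D : InD (parent a) ≡ true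
    pa∈D = depth≡0⇒root (parent-Reachable (reachable a))
             (suc-injective (trans (sym (depth-parent ¬Da (reachable a))) d≡1))
    inBranch? : Decidable (InBranch a)
    inBranch? x = (InD x Bool.≟ false) ×-dec (top x ≟ a)

  branch-hasGoodEdge : ∀ {a} → depth a ≡ 1 → ∃ λ w → Ancestor a w × HasGoodEdge w
  branch-hasGoodEdge {a} d≡1 with true-or-false (side a)
  ... | inj₁ upper = upper-branch-hasGoodEdge upper
  ... | inj₂ lower = lower-branch-hasGoodEdge d≡1 lower

  top-InD′ : ∀ {v} → InD v ≡ false → InD′ (top v)
  top-InD′ ¬Dv = inj₂ (branch-hasGoodEdge (depth-top ¬Dv (reachable _)))

  D′-dominating : StepDominating G m D′
  D′-dominating v with true-or-false (InD v)
  ... | inj₁ Dv  = v , InD′⇒∈D′ (inj₁ Dv) , [] , z≤n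
  ... | inj₂ ¬Dv = top v , InD′⇒∈D′ (top-InD′ ¬Dv) , climb (pred (depth v)) v pred[n]≤n (reachable v) ,
                   subst (_≤ m) (sym (len-climb _ v _ _)) (pred-mono-≤ (depth-≤ v))

  module Colouring (K : ℕ) (D-colouring : RainbowColouring (G [ D ]) K) where
    open Induced G D using (Vertex; extend; extend-sym; restrict-extend; lower; All-verts-lower; colours-lower)

    cD : Vertex → Vertex → ℕ
    cD = proj₁ D-colouring

    cD-< : ∀ a b → Adj (G [ D ]) a b → cD a b < K
    cD-< = proj₁ (proj₂ (proj₂ D-colouring))

    cD-path : ∀ a b → Σ[ p ∈ Walk (Adj (G [ D ])) a b ] (IsPath p × Rainbow cD p)
    cD-path = proj₂ (proj₂ (proj₂ D-colouring))

    L2 : ℕ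
    L2 = suc (l + l)

    treeColour : Bool → ℕ → ℕ
    treeColour false j = K + (j ∸ 1)
    treeColour true  j = K + (L2 ∸ j)

    label : Fin n → ℕ
    label x = treeColour (side (top x)) (depth x)

    no-2-cycle : ∀ {x} → not (InD x) ≡ true → not (InD (parent x)) ≡ true → parent (parent x) ≢ x
    no-2-cycle cx cpx = parent-parent≢ (not-true⁻ cx) (reachable _) (not-true⁻ cpx)

    open TreeColouring _≟_ parent (λ x → not (InD x)) no-2-cycle label (K + l)

    c′ : Fin n → Fin n → ℕ
    c′ u v = if InD u ∧ InD v then extend cD u v else colouring u v

    c′-sym : ∀ u v → c′ u v ≡ c′ v u
    c′-sym u v = if-∧-swap (InD u) (InD v) (extend-sym cD (proj₁ (proj₂ D-colouring)) u v) (colouring-sym u v)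

    c′-D : ∀ {u v} (u∈D : u ∈ D) (v∈D : v ∈ D) → c′ u v ≡ cD (u , u∈D) (v , v∈D)
    c′-D {u} {v} u∈D v∈D =
      trans (if-true (∧-true ([]=⇒lookup u∈D) ([]=⇒lookup v∈D))) (restrict-extend cD (u , u∈D) (v , v∈D))

    c′-child : ∀ {x} → InD x ≡ false → c′ x (parent x) ≡ label x
    c′-child {x} ¬Dx =
      trans (if-false (cong (_∧ InD (parent x)) ¬Dx)) (colouring-child-parent (not-false ¬Dx , refl))

    c′-good : ∀ {w w′} → InD w ≡ false → GoodEdge w w′ → c′ w w′ ≡ K + l
    c′-good {w} {w′} ¬Dw good = trans (if-false (cong (_∧ InD w′) ¬Dw)) (colouring-other (¬w′w good) (¬ww′ good))
      where
      ¬w′w : GoodEdge w w′ → ¬ ChildOf w′ w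
      ¬w′w (inj₁ (Dw′ , _))        (cw′ , _)     = false⇒¬true (not-true⁻ cw′) Dw′
      ¬w′w (inj₂ (¬Dw′ , sides≢)) (_ , pw′≡w) =
        sides≢ (cong side (trans (sym (top-parent ¬Dw′ (reachable w′) (subst (λ z → InD z ≡ false) (sym pw′≡w) ¬Dw)))
                                 (cong top pw′≡w)))
      ¬ww′ : GoodEdge w w′ → ¬ ChildOf w w′
      ¬ww′ (inj₁ (_ , pw≢w′))      (_ , pw≡w′) = pw≢w′ pw≡w′
      ¬ww′ (inj₂ (¬Dw′ , sides≢)) (_ , pw≡w′) =
        sides≢ (cong side (trans (sym (cong top pw≡w′))
                                 (top-parent ¬Dw (reachable w) (subst (λ z → InD z ≡ false) (sym pw≡w′) ¬Dw′))))

    treeColour-< : ∀ s {j} → 0 < j → j ≤ l → treeColour s j < K + L2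
    treeColour-< false 0<j j≤l = +-monoʳ-< K (s≤s (≤-trans (m∸n≤m _ 1) (≤-trans j≤l (m≤m+n l l))))
    treeColour-< true  0<j j≤l = +-monoʳ-< K (∸-monoʳ-< 0<j (≤-trans j≤l (≤-trans (m≤m+n l l) (n≤1+n _))))

    label-< : ∀ {x y} → ChildOf x y → label x < K + L2
    label-< {x} (cx , _) = treeColour-< (side (top x)) (nonroot⇒depth>0 (not-true⁻ cx) (reachable x)) (depth-≤ x)

    cross-< : K + l < K + L2
    cross-< = +-monoʳ-< K (s≤s (m≤m+n l l))

    c′-< : ∀ u v → Adj G u v → c′ u v < K + L2
    c′-< u v uv with true-or-false (InD u ∧ InD v)
    ... | inj₁ DuDv = subst (_< K + L2) (sym (c′-D u∈D v∈D))
                        (<-≤-trans (cD-< _ _ uv) (m≤m+n K L2))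
      where u∈D = lookup⇒[]= u D (∧-true⁻ˡ _ DuDv)
            v∈D = lookup⇒[]= v D (∧-true⁻ʳ (InD u) DuDv)
    ... | inj₂ ¬DuDv = subst (_< K + L2) (sym (if-false ¬DuDv)) (colouring-elim (_< K + L2) label-< cross-< u v)

    ≤l⇒<L2 : ∀ {j} → j ≤ l → j < L2
    ≤l⇒<L2 j≤l = s≤s (≤-trans j≤l (m≤m+n l l))

    side-parent : ∀ {i w} → suc (suc i) ≤ depth w → side (top (parent w)) ≡ side (top w)
    side-parent {w = w} i<d = cong side (top-parent (<depth⇒nonroot i<d) (reachable w)
                                          (<depth⇒nonroot (<depth⇒≤depth-parent i<d (reachable w))))

    module _ {i w} (i<d : suc i ≤ depth w) (rw : Reachable w) where
      private
        dp = depth (parent w)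
        d≡ : depth w ≡ suc dp
        d≡ = depth-parent (<depth⇒nonroot i<d) rw
        tail = colours c′ (climb i (parent w) (<depth⇒≤depth-parent i<d rw) (parent-Reachable rw))
        head≡ : ∀ s → side (top w) ≡ s → c′ w (parent w) ≡ treeColour s (depth w)
        head≡ s side≡ = trans (c′-child (<depth⇒nonroot i<d)) (cong (λ s → treeColour s (depth w)) side≡)

      climb-lower-step : side (top w) ≡ false → RainbowIn (K + (dp ∸ i)) (K + dp) tail →
                         RainbowIn (K + (depth w ∸ suc i)) (K + depth w) (colours c′ (climb (suc i) w i<d rw))
      climb-lower-step lower tail-in =
        RainbowIn-cong (cong (λ d → K + (d ∸ suc i)) (sym d≡)) (trans (sym (+-suc K dp)) (cong (K +_) (sym d≡)))
                       (cong (_∷ tail) (sym head)) (RainbowIn-∷-top (+-monoʳ-≤ K (m∸n≤m dp i)) tail-in)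
        where
        head : c′ w (parent w) ≡ K + dp
        head = trans (head≡ false lower) (cong (λ d → K + (d ∸ 1)) d≡)

      climb-upper-step : side (top w) ≡ true → RainbowIn (K + (L2 ∸ dp)) (K + (L2 ∸ (dp ∸ i))) tail →
                         RainbowIn (K + (L2 ∸ depth w)) (K + (L2 ∸ (depth w ∸ suc i)))
                                   (colours c′ (climb (suc i) w i<d rw))
      climb-upper-step upper tail-in =
        RainbowIn-cong (cong (λ d → K + (L2 ∸ d)) (sym d≡)) (cong (λ d → K + (L2 ∸ (d ∸ suc i))) (sym d≡))
                       (cong (_∷ tail) (sym head))
                       (RainbowIn-∷-bottom (+-monoʳ-< K (∸-monoʳ-< (s≤s (m∸n≤m dp i)) sdp≤L2))
                                           (RainbowIn-cong lo≡ refl refl tail-in))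
        where
        sdp≤L2 : suc dp ≤ L2
        sdp≤L2 = <⇒≤ (subst (_< L2) d≡ (≤l⇒<L2 (depth-≤ w)))
        head : c′ w (parent w) ≡ K + (L2 ∸ suc dp)
        head = trans (head≡ true upper) (cong (λ d → K + (L2 ∸ d)) d≡)
        lo≡ : K + (L2 ∸ dp) ≡ suc (K + (L2 ∸ suc dp))
        lo≡ = trans (cong (K +_) (+-∸-assoc 1 sdp≤L2)) (+-suc K _)

    climb-lower : ∀ i w i≤d rw → side (top w) ≡ false →
                  RainbowIn (K + (depth w ∸ i)) (K + depth w) (colours c′ (climb i w i≤d rw))
    climb-lower zero          w _   _  _     = RainbowIn-[]
    climb-lower (suc zero)    w i<d rw lower = climb-lower-step i<d rw lower RainbowIn-[]
    climb-lower (suc (suc i)) w i<d rw lower =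
      climb-lower-step i<d rw lower (climb-lower (suc i) (parent w) _ _ (trans (side-parent i<d) lower))

    climb-upper : ∀ i w i≤d rw → side (top w) ≡ true →
                  RainbowIn (K + (L2 ∸ depth w)) (K + (L2 ∸ (depth w ∸ i))) (colours c′ (climb i w i≤d rw))
    climb-upper zero          w _   _  _     = RainbowIn-[]
    climb-upper (suc zero)    w i<d rw upper = climb-upper-step i<d rw upper RainbowIn-[]
    climb-upper (suc (suc i)) w i<d rw upper =
      climb-upper-step i<d rw upper (climb-upper (suc i) (parent w) _ _ (trans (side-parent i<d) upper))

    toRoot-lower : ∀ {x} → side (top x) ≡ false → RainbowIn K (K + depth x) (colours c′ (toRoot x (reachable x)))
    toRoot-lower {x} lower = RainbowIn-weaken (m≤m+n K _) ≤-refl (climb-lower (depth x) x ≤-refl (reachable x) lower)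

    toRoot-upper : ∀ {x} → side (top x) ≡ true →
                   RainbowIn (K + (L2 ∸ depth x)) (K + L2) (colours c′ (toRoot x (reachable x)))
    toRoot-upper {x} upper = RainbowIn-cong refl (cong (λ d → K + (L2 ∸ d)) (n∸n≡0 (depth x))) refl
                                            (climb-upper (depth x) x ≤-refl (reachable x) upper)

    toRoot-root : ∀ {x} → InD x ≡ true → colours c′ (toRoot x (reachable x)) ≡ []
    toRoot-root {x} Dx = len≡0⇒colours≡[] c′ (toRoot x _) (trans (len-climb (depth x) x _ _) (root⇒depth≡0 Dx))

    All-verts-toRoot : ∀ {x} → InD′ x → All InD′ (verts (toRoot x (reachable x)))
    All-verts-toRoot {x} = All-verts-climb (λ _ → InD′-parent) (depth x) x ≤-refl (reachable x)

    upper-block : ∀ {j} → j ≤ l → suc (K + l) ≤ K + (L2 ∸ j)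
    upper-block {j} j≤l = subst (_≤ K + (L2 ∸ j)) (+-suc K l)
                                (+-monoʳ-≤ K (subst (_≤ L2 ∸ j) (m+n∸n≡m (suc l) l) (∸-monoʳ-≤ L2 j≤l)))

    -- the far endpoint of a good edge climbs to D in the colour block not used by the near one
    partner-upper : ∀ {w w′} → side (top w) ≡ false → GoodEdge w w′ →
                    RainbowIn (suc (K + l)) (K + L2) (colours c′ (toRoot w′ (reachable w′)))
    partner-upper lower (inj₁ (Dw′ , _))     = subst (RainbowIn _ _) (sym (toRoot-root Dw′)) RainbowIn-[]
    partner-upper {w′ = w′} lower (inj₂ (_ , sides≢)) =
      RainbowIn-weaken (upper-block (depth-≤ w′)) ≤-refl (toRoot-upper (trans (¬-not sides≢) (cong not lower)))

    partner-lower : ∀ {w w′} → side (top w) ≡ true → GoodEdge w w′ →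
                    RainbowIn K (K + l) (colours c′ (toRoot w′ (reachable w′)))
    partner-lower upper (inj₁ (Dw′ , _))     = subst (RainbowIn _ _) (sym (toRoot-root Dw′)) RainbowIn-[]
    partner-lower {w′ = w′} upper (inj₂ (_ , sides≢)) =
      RainbowIn-weaken ≤-refl (+-monoʳ-≤ K (depth-≤ w′)) (toRoot-lower (trans (¬-not sides≢) (cong not upper)))

    partner-InD′ : ∀ {w w′} → InD w ≡ false → Adj G w w′ → GoodEdge w w′ → InD′ w′
    partner-InD′ ¬Dw ww′ (inj₁ (Dw′ , _))       = inj₁ Dw′
    partner-InD′ ¬Dw ww′ (inj₂ (¬Dw′ , sides≢)) =
      inj₂ (_ , Ancestor-self ¬Dw′ (reachable _) , _ , Adj-sym G ww′ , inj₂ (¬Dw , λ same → sides≢ (sym same)))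

    record Escape (v : Fin n) (lo hi : ℕ) : Set where
      constructor escape
      field
        {end}   : Fin n
        end∈D   : InD end ≡ true
        walk    : Walk (Adj G) v end
        within  : All InD′ (verts walk)
        rainbow : RainbowIn lo hi (colours c′ walk)

    Escapes : Fin n → Set
    Escapes v = ∃ λ a → a ≤ L2 × Escape v K (K + a) × Escape v (K + a) (K + L2)

    -- From the ancestor v = parent^ i w of an endpoint w of a good edge ww′: down to w, across, up to D.
    module Descent {w w′} (i : ℕ) (i<d : i < depth w) (ww′ : Adj G w w′) (good : GoodEdge w w′) where
      v = parent^ i w

      ¬Dw : InD w ≡ false
      ¬Dw = <depth⇒nonroot i<d

      climbed : Walk (Adj G) w v
      climbed = climb i w (<⇒≤ i<d) (reachable w)

      descent : Walk (Adj G) v (root w′)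
      descent = reverseʷ (Adj-sym G) climbed ++ʷ step ww′ (toRoot w′ (reachable w′))

      depth-v : depth w ∸ i ≡ depth v
      depth-v = trans (cong (_∸ i) (sym (Ancestor-depth (reachable w) (i , i<d , refl)))) (m+n∸n≡m (depth v) i)

      colours-descent : colours c′ descent
                        ≡ reverse (colours c′ climbed) ++ K + l ∷ colours c′ (toRoot w′ (reachable w′))
      colours-descent = trans (colours-++ʷ c′ (reverseʷ (Adj-sym G) climbed) _)
                              (cong₂ _++_ (colours-reverseʷ (Adj-sym G) c′ c′-sym climbed)
                                          (cong (_∷ _) (c′-good ¬Dw good)))

      descent-inside : All InD′ (verts descent)
      descent-inside = All-verts-++ʷ (reverseʷ (Adj-sym G) climbed) _
        (All-verts-reverseʷ (Adj-sym G) climbed (All-verts-climb (λ _ → InD′-parent) i w _ _ InD′-w))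
        (InD′-w ∷ All-verts-toRoot (partner-InD′ ¬Dw ww′ good))
        where InD′-w = inj₂ (w , Ancestor-self ¬Dw (reachable w) , w′ , ww′ , good)

      descent-lower : side (top w) ≡ false → RainbowIn (K + depth v) (K + L2) (colours c′ descent)
      descent-lower lower = subst (RainbowIn _ _) (sym colours-descent)
        (RainbowIn-++ (+-monoʳ-≤ K (depth-≤ v)) ≤-refl (<⇒≤ cross-<)
          (RainbowIn-weaken (≤-reflexive (cong (K +_) (sym depth-v))) (+-monoʳ-≤ K (depth-≤ w))
            (RainbowIn-reverse (climb-lower i w _ _ lower)))
          (RainbowIn-∷-bottom cross-< (partner-upper lower good)))

      descent-upper : side (top w) ≡ true → RainbowIn K (K + (L2 ∸ depth v)) (colours c′ descent)
      descent-upper upper = subst (RainbowIn _ _) (sym colours-descent)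
        (RainbowIn-++-descending (≤-trans (m≤m+n K l) (n≤1+n _)) ≤-refl (upper-block (depth-≤ v))
          (RainbowIn-weaken (upper-block (depth-≤ w)) (≤-reflexive (cong (λ d → K + (L2 ∸ d)) depth-v))
            (RainbowIn-reverse (climb-upper i w _ _ upper)))
          (RainbowIn-∷-top (m≤m+n K l) (partner-lower upper good)))

    escapes : ∀ {v} → InD′ v → Escapes v
    escapes {v} (inj₁ Dv) = 0 , z≤n , stay , stay
      where stay : ∀ {lo hi} → Escape v lo hi
            stay = escape Dv [] (inj₁ Dv ∷ []) RainbowIn-[]
    escapes v∈@(inj₂ (w , (i , i<d , refl) , w′ , ww′ , good)) with true-or-false (side (top w))
    ... | inj₂ lower =
      depth v , ≤-trans (depth-≤ v) (<⇒≤ (≤l⇒<L2 ≤-refl)) ,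
      escape (root-R (reachable v)) (toRoot v (reachable v)) (All-verts-toRoot v∈)
             (toRoot-lower (trans (cong side (Ancestor-top (reachable w) (i , i<d , refl))) lower)) ,
      escape (root-R (reachable w′)) descent descent-inside (descent-lower lower)
      where open Descent i i<d ww′ good
    ... | inj₁ upper =
      L2 ∸ depth v , m∸n≤m L2 (depth v) ,
      escape (root-R (reachable w′)) descent descent-inside (descent-upper upper) ,
      escape (root-R (reachable v)) (toRoot v (reachable v)) (All-verts-toRoot v∈)
             (toRoot-upper (trans (cong side (Ancestor-top (reachable w) (i , i<d , refl))) upper))
      where open Descent i i<d ww′ good

    RainbowWalkInD′ : Fin n → Fin n → Set
    RainbowWalkInD′ u v = Σ[ p ∈ Walk (Adj G) u v ] (All InD′ (verts p) × Rainbow c′ p)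

    reverse-RainbowWalkInD′ : ∀ {u v} → RainbowWalkInD′ u v → RainbowWalkInD′ v u
    reverse-RainbowWalkInD′ (p , p-in , p-rb) =
      reverseʷ (Adj-sym G) p , All-verts-reverseʷ (Adj-sym G) p p-in ,
      subst Unique (sym (colours-reverseʷ (Adj-sym G) c′ c′-sym p)) (Unique-reverse p-rb)

    D-walk : ∀ {x y} → InD x ≡ true → InD y ≡ true →
             Σ[ p ∈ Walk (Adj G) x y ] (All InD′ (verts p) × RainbowIn 0 K (colours c′ p))
    D-walk {x} {y} Dx Dy =
      lower p , All.map (λ z∈D → inj₁ ([]=⇒lookup z∈D)) (All-verts-lower p) ,
      subst (RainbowIn 0 K) (sym colours≡) (p-rb , All-colours cD (λ e → z≤n , cD-< _ _ e) p)
      where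
      x∈D = lookup⇒[]= x D Dx
      y∈D = lookup⇒[]= y D Dy
      p    = proj₁ (cD-path (x , x∈D) (y , y∈D))
      p-rb = proj₂ (proj₂ (cD-path (x , x∈D) (y , y∈D)))
      colours≡ : colours c′ (lower p) ≡ colours cD p
      colours≡ = colours-lower c′ cD (λ a b → c′-D (proj₂ a) (proj₂ b)) p

    -- out of u through colours below K + a, across D with colours below K, into v from colours ≥ K + b
    join : ∀ {u v a b} → a ≤ b → b ≤ L2 → Escape u K (K + a) → Escape v (K + b) (K + L2) → RainbowWalkInD′ u v
    join a≤b b≤L2 (escape Du p p-in p-rb) (escape Dv q q-in q-rb) =
      W , All-verts-++ʷ (p ++ʷ d) _ (All-verts-++ʷ p d p-in d-in) (All-verts-reverseʷ (Adj-sym G) q q-in) ,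
      subst Unique (sym colours≡)
        (proj₁ (RainbowIn-++ z≤n (+-monoʳ-≤ K a≤b) (+-monoʳ-≤ K b≤L2)
                 (RainbowIn-++-descending z≤n ≤-refl (m≤m+n K _) p-rb d-rb) (RainbowIn-reverse q-rb)))
      where
      d-walk = D-walk Du Dv
      d    = proj₁ d-walk
      d-in = proj₁ (proj₂ d-walk)
      d-rb = proj₂ (proj₂ d-walk)
      W = (p ++ʷ d) ++ʷ reverseʷ (Adj-sym G) q
      colours≡ : colours c′ W ≡ (colours c′ p ++ colours c′ d) ++ reverse (colours c′ q)
      colours≡ = trans (colours-++ʷ c′ (p ++ʷ d) _)
                       (cong₂ _++_ (colours-++ʷ c′ p d) (colours-reverseʷ (Adj-sym G) c′ c′-sym q))

    rainbowWalkInD′ : ∀ {u v} → InD′ u → InD′ v → RainbowWalkInD′ u v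
    rainbowWalkInD′ u∈ v∈ with escapes u∈ | escapes v∈
    ... | a , a≤L2 , low-u , high-u | b , b≤L2 , low-v , high-v with a ≤? b
    ...   | yes a≤b = join a≤b b≤L2 low-u high-v
    ...   | no  a≰b = reverse-RainbowWalkInD′ (join (<⇒≤ (≰⇒> a≰b)) a≤L2 low-v high-u)

    D′-colouring : RainbowColouring (G [ D′ ]) (K + L2)
    D′-colouring = rainbowWalksInside⇒RainbowColouring (K + L2) c′ c′-sym (λ _ _ → c′-< _ _) walk
      where
      open Induced G D′ using (rainbowWalksInside⇒RainbowColouring)
      walk : ∀ {u v} → u ∈ D′ → v ∈ D′ → Σ[ p ∈ Walk (Adj G) u v ] (All (_∈ D′) (verts p) × Rainbow c′ p)
      walk u∈D′ v∈D′ = let (p , p-in , p-rb) = rainbowWalkInD′ (∈D′⇒InD′ u∈D′) (∈D′⇒InD′ v∈D′) in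
                       p , All.map InD′⇒∈D′ p-in , p-rb

0-StepDominating⇒everywhere : ∀ {n} {G : Graph (Fin n)} {D} → StepDominating G 0 D → ∀ v → v ∈ D
0-StepDominating⇒everywhere dominating v with dominating v
... | u , u∈D , [] , _ = u∈D

refine : ∀ {n} (G : Graph (Fin n)) → Bridgeless G → ∀ m (D : Subset n) → ConnStepDominating G (suc m) D →
         ∀ K → RainbowColouring (G [ D ]) K →
         ∃ λ D′ → ConnStepDominating G m D′ × RainbowColouring (G [ D′ ]) (K + suc (suc m + suc m))
refine G bridgeless m D (D-dominating , ((x , x∈D) , _)) K D-colouring =
  D′ , (D′-dominating , RainbowColouring⇒Connected {G = G [ D′ ]} x′ D′-colouring) , D′-colouring
  where
  open Refinement G bridgeless m D D-dominating
  open Colouring K D-colouring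
  x′ : Σ (Fin _) (_∈ D′)
  x′ = x , InD′⇒∈D′ (inj₁ ([]=⇒lookup x∈D))

-- l (l + 2) = (l - 1)(l + 1) + (2 l + 1)
colour-count : ∀ k m → k + suc (suc m + suc m) + m * (m + 2) ≡ k + suc m * (suc m + 2)
colour-count = solve-∀

rainbowColouring-from-dominating : ∀ {n} (G : Graph (Fin n)) → Bridgeless G →
                                   ∀ l (D : Subset n) → ConnStepDominating G l D →
                                   ∀ k → RainbowColouring (G [ D ]) k → RainbowColouring G (k + l * (l + 2))
rainbowColouring-from-dominating G bridgeless zero    D (D-dominating , _) k D-colouring =
  subst (RainbowColouring G) (sym (+-identityʳ k))
        (Induced.RainbowColouring-spanning G D (0-StepDominating⇒everywhere {G = G} D-dominating) D-colouring)
rainbowColouring-from-dominating G bridgeless (suc m) D D-cds k D-colouring =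
  let (D′ , D′-cds , D′-colouring) = refine G bridgeless m D D-cds k D-colouring in
  subst (RainbowColouring G) (colour-count k m)
        (rainbowColouring-from-dominating G bridgeless m D′ D′-cds _ D′-colouring)

-- G is connected because D is connected and dominates it.
lemma2 : ∀ {n} (G : Graph (Fin n)) → Connected (Adj G) → Bridgeless G →
         (l : ℕ) (D : Subset n) → ConnStepDominating G l D →
         (∀ k → RainbowColouring (G [ D ]) k → RainbowColouring G (k + l * (l + 2)))
         × RainbowColouring (G [ D ]) (∣ D ∣ ∸ 1)
lemma2 G _ bridgeless l D D-cds =
  rainbowColouring-from-dominating G bridgeless l D D-cds , SpanningTree.rainbowColouring G D (proj₂ D-cds)
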